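{- Let $t\to_{\mathsf G} s$ be a good step and suppose $s=B\langle v\rangle$ where $B$ is a bad context and $v$ is a value occurring as a subterm of $s$ at that position. Then $t=B'\langle v'\rangle$ for some bad context $B'$ and some value $v'$ (a subterm of $t$ at that position) such that $|v|=|v'|$.
   Context: Exponential substitution calculus. Variables: multiplicative $m,n,o,\ldots$ and exponential $e,f,g,\ldots$ (disjoint kinds); $x,y,z$ range over both. Multiplicative values $v_{\mathsf m} ::= m \mid (t,s) \mid \lambda x.t$; exponential values $v_{\mathsf e} ::= e \mid\ !t$; values $v ::= v_{\mathsf m}\mid v_{\mathsf e}$. Terms: $t,s,u ::= v \mid \mathsf{cut}(v,x.t) \mid \mathsf{par}(m,x.y.t) \mid \mathsf{sub}(m,v,x.t) \mid \mathsf{der}(e,x.t)$; in $\lambda x.t$, cut, sub, der $x$ is bound in $t$, in par $x,y$ are bound; terms up to $\alpha$; $\mathrm{fv}$ = free variables; $|t|$ = size of $t$ (number of constructor occurrences). Left contexts $L ::= \langle\cdot\rangle \mid \mathsf{cut}(v,x.L)\mid\mathsf{par}(m,x.y.L)\mid\mathsf{sub}(m,v,x.L)\mid\mathsf{der}(e,x.L)$; every term is uniquely $L\langle v\rangle$. Value contexts $V ::= \langle\cdot\rangle \mid (C,s)\mid (t,C)\mid\lambda x.C\mid\ !C$; general contexts $C ::= V \mid \mathsf{cut}(V,x.t)\mid\mathsf{sub}(m,V,x.t)\mid L\langle C\rangle$; multiplicative value contexts $V_{\mathsf m} ::= \langle\cdot\rangle\mid (M,s)\mid(t,M)\mid\lambda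 x.M$; multiplicative contexts $M ::= V_{\mathsf m}\mid \mathsf{cut}(V_{\mathsf m},x.t)\mid \mathsf{sub}(m,V_{\mathsf m},x.t)\mid L\langle M\rangle$. Plugging $C\langle t\rangle$ replaces the hole (may capture), except that if $t=L\langle v\rangle$ then $\mathsf{cut}(\langle\cdot\rangle,x.s)\langle t\rangle := L\langle\mathsf{cut}(v,x.s)\rangle$ and $\mathsf{sub}(m,\langle\cdot\rangle,x.s)\langle t\rangle := L\langle\mathsf{sub}(m,v,x.s)\rangle$; $C\langle\!\langle t\rangle\!\rangle$ is capture-avoiding plugging. For multiplicative $m,n$, $\{n/m\}t$ is renaming. Micro-step root rules (context does not capture the cut variable): (ax$_{m1}$) $\mathsf{cut}(v_{\mathsf m},m.M\langle\!\langle m\rangle\!\rangle)\mapsto M\langle\!\langle v_{\mathsf m}\rangle\!\rangle$; (ax$_{m2}$) $\mathsf{cut}(n,m.t)\mapsto \{n/m\}t$; ($\otimes$) $\mathsf{cut}((s,u),m.M\langle\mathsf{par}(m,x.y.t)\rangle)\mapsto M\langle L\langle\mathsf{cut}(v,x.L'\langle\mathsf{cut}(v',y.t)\rangle)\rangle\rangle$ where $s=L\langle v\rangle$, $u=L'\langle v'\rangle$; ($\multimap$) $\mathsf{cut}(\lambda y.s,m.M\langle\mathsf{sub}(m,v,x.t)\rangle)\mapsto M\langle\mathsf{cut}(v,y.L\langle\mathsf{cut}(v',x.t)\rangle)\rangle$ where $s=L\langle v'\rangle$; (ax$_{e1}$) $\mathsf{cut}(v_{\mathsf e},e.C\langle\!\langle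 e\rangle\!\rangle)\mapsto\mathsf{cut}(v_{\mathsf e},e.C\langle\!\langle v_{\mathsf e}\rangle\!\rangle)$; (ax$_{e2}$) $\mathsf{cut}(f,e.C\langle\mathsf{der}(e,x.t)\rangle)\mapsto\mathsf{cut}(f,e.C\langle\mathsf{der}(f,x.t)\rangle)$; (!der) $\mathsf{cut}(!s,e.C\langle\mathsf{der}(e,x.t)\rangle)\mapsto\mathsf{cut}(!s,e.C\langle L\langle\mathsf{cut}(v,x.t)\rangle\rangle)$ where $s=L\langle v\rangle$; (w) $\mathsf{cut}(v_{\mathsf e},e.t)\mapsto t$ if $e\notin\mathrm{fv}(t)$. $\to_{\mathrm{ms}}$ is the union of their closures under general contexts. Positions of redexes: every non-(w) step reduces a term $t=C\langle\mathsf{cut}(v,x.D\langle t_x\rangle)\rangle$ where the fired cut is the one on $x$ and $t_x$ is the occurrence of $x$ it acts on (a subterm of form $x$, $\mathsf{par}(x,\ldots)$, $\mathsf{sub}(x,\ldots)$ or $\mathsf{der}(x,\ldots)$); its position is the context $C\langle\mathsf{cut}(v,x.D)\rangle$. A (w) step $C\langle t\rangle\to C\langle s\rangle$ with $t\mapsto_w s$ has position $C$. In positions, the plugged term is an actual subterm. Dominating free variables $\mathrm{dfv}(C)$: $\mathrm{dfv}(\langle\cdot\rangle)=\emptyset$; $\mathrm{dfv}((C,v))=\mathrm{dfv}((v,C))=\mathrm{dfv}(!C)=\mathrm{dfv}(C)$; $\mathrm{dfv}(\lambda x.C)=\mathrm{dfv}(C)\setminus\{x\}$; $\mathrm{dfv}(\mathsf{cut}(v,x.C))=\mathrm{dfv}(C)\setminus\{x\}$;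 $\mathrm{dfv}(\mathsf{cut}(V,x.t))=\mathrm{dfv}(V)$; $\mathrm{dfv}(\mathsf{par}(m,x.y.C))=\{m\}\cup(\mathrm{dfv}(C)\setminus\{x,y\})$ if $x\in\mathrm{dfv}(C)$ or $y\in\mathrm{dfv}(C)$, else $\mathrm{dfv}(C)$; $\mathrm{dfv}(\mathsf{sub}(m,V,x.t))=\{m\}\cup\mathrm{dfv}(V)$; $\mathrm{dfv}(\mathsf{sub}(m,v,x.C))=\{m\}\cup(\mathrm{dfv}(C)\setminus\{x\})$ if $x\in\mathrm{dfv}(C)$, else $\mathrm{dfv}(C)$; $\mathrm{dfv}(\mathsf{der}(e,x.C))=\{e\}\cup(\mathrm{dfv}(C)\setminus\{x\})$ if $x\in\mathrm{dfv}(C)$, else $\mathrm{dfv}(C)$. Good value contexts $V_G ::= \langle\cdot\rangle\mid(G,t)\mid(t,G)\mid\lambda x.G\mid\ !G$; good contexts $G ::= V_G\mid\mathsf{par}(m,x.y.G)\mid\mathsf{sub}(m,v,x.G)\mid\mathsf{sub}(m,V_G,x.t)\mid\mathsf{der}(e,x.G)\mid\mathsf{cut}(v,x.G)$ provided $x\notin\mathrm{dfv}(G)$. A bad context is a context that is not good. A $\to_{\mathrm{ms}}$ step is good, written $\to_{\mathsf G}$, if its position is a good context. -}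

module Defs where

open import Data.Nat using (ℕ; zero; suc; _+_)
open import Data.List using (List; []; _∷_)
open import Data.Empty using (⊥)
open import Data.Product using (_×_)
open import Data.Sum using (_⊎_)
open import Relation.Nullary using (¬_)
open import Relation.Binary.PropositionalEquality using (_≡_)

data Kind : Set where
  mul exp : Kind

Scope : Set
Scope = List Kind

data _∋_ : Scope → Kind → Set where
  here  : ∀ {Γ k} → (k ∷ Γ) ∋ k
  there : ∀ {Γ k k'} → Γ ∋ k → (k' ∷ Γ) ∋ k

infix 4 _∋_

-- position of a variable in the scope (used to compare variables of
-- possibly different kinds)
idx : ∀ {Γ k} → Γ ∋ k → ℕ
idx here      = zero
idx (there x) = suc (idx x)

SameVar : ∀ {Γ k k'} → Γ ∋ k → Γ ∋ k' → Set
SameVar x y = idx x ≡ idx y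

-- Values and terms.
--   var x        : m or e (kind given by the variable)
--   pair t s     : (t,s)
--   lam k t      : λx.t, x of kind k
--   bang t       : !t
--   cut k v t    : cut(v, x.t), x of kind k
--   par m k1 k2 t: par(m, x.y.t), x of kind k1 (index 1), y of kind k2 (index 0)
--   sub m v k t  : sub(m, v, x.t)
--   der e k t    : der(e, x.t)

mutual
  data Val (Γ : Scope) : Set where
    var  : ∀ {k} → Γ ∋ k → Val Γ
    pair : Tm Γ → Tm Γ → Val Γ
    lam  : (k : Kind) → Tm (k ∷ Γ) → Val Γ
    bang : Tm Γ → Val Γ

  data Tm (Γ : Scope) : Set where
    val : Val Γ → Tm Γ
    cut : (k : Kind) → Val Γ → Tm (k ∷ Γ) → Tm Γ
    par : Γ ∋ mul → (k1 k2 : Kind) → Tm (k2 ∷ k1 ∷ Γ) → Tm Γ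
    sub : Γ ∋ mul → Val Γ → (k : Kind) → Tm (k ∷ Γ) → Tm Γ
    der : Γ ∋ exp → (k : Kind) → Tm (k ∷ Γ) → Tm Γ

data MulVal {Γ} : Val Γ → Set where
  mv-var  : (x : Γ ∋ mul) → MulVal (var x)
  mv-pair : ∀ t s → MulVal (pair t s)
  mv-lam  : ∀ k t → MulVal (lam k t)

data ExpVal {Γ} : Val Γ → Set where
  ev-var  : (x : Γ ∋ exp) → ExpVal (var x)
  ev-bang : ∀ t → ExpVal (bang t)

mutual
  sizeV : ∀ {Γ} → Val Γ → ℕ
  sizeV (var x)    = 1
  sizeV (pair t s) = suc (size t + size s)
  sizeV (lam k t)  = suc (size t)
  sizeV (bang t)   = suc (size t)

  size : ∀ {Γ} → Tm Γ → ℕ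
  size (val v)         = sizeV v
  size (cut k v t)     = suc (sizeV v + size t)
  size (par m k1 k2 t) = suc (size t)
  size (sub m v k t)   = suc (sizeV v + size t)
  size (der e k t)     = suc (size t)

Ren : Scope → Scope → Set
Ren Γ Δ = ∀ {k} → Γ ∋ k → Δ ∋ k

lift : ∀ {Γ Δ k} → Ren Γ Δ → Ren (k ∷ Γ) (k ∷ Δ)
lift ρ here      = here
lift ρ (there x) = there (ρ x)

_∘ʳ_ : ∀ {Γ Δ Ε} → Ren Δ Ε → Ren Γ Δ → Ren Γ Ε
(ρ ∘ʳ σ) x = ρ (σ x)

[_/0] : ∀ {Γ} → Γ ∋ mul → Ren (mul ∷ Γ) Γ
[ n /0] here      = n
[ n /0] (there x) = x

-- Binder lists: a context with binder list Θ (outermost first) over Γ has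
-- its hole in scope Θ ⋈ Γ.
_⋈_ : List Kind → Scope → Scope
[]      ⋈ Γ = Γ
(k ∷ Θ) ⋈ Γ = Θ ⋈ (k ∷ Γ)

wkΘ : ∀ {Γ} Θ → Ren Γ (Θ ⋈ Γ)
wkΘ []      x = x
wkΘ (k ∷ Θ) x = wkΘ Θ (there x)

liftΘ : ∀ {Γ Δ} Θ → Ren Γ Δ → Ren (Θ ⋈ Γ) (Θ ⋈ Δ)
liftΘ []      ρ = ρ
liftΘ (k ∷ Θ) ρ = liftΘ Θ (lift ρ)

mutual
  renV : ∀ {Γ Δ} → Ren Γ Δ → Val Γ → Val Δ
  renV ρ (var x)    = var (ρ x)
  renV ρ (pair t s) = pair (ren ρ t) (ren ρ s)
  renV ρ (lam k t)  = lam k (ren (lift ρ) t)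
  renV ρ (bang t)   = bang (ren ρ t)

  ren : ∀ {Γ Δ} → Ren Γ Δ → Tm Γ → Tm Δ
  ren ρ (val v)         = val (renV ρ v)
  ren ρ (cut k v t)     = cut k (renV ρ v) (ren (lift ρ) t)
  ren ρ (par m k1 k2 t) = par (ρ m) k1 k2 (ren (lift (lift ρ)) t)
  ren ρ (sub m v k t)   = sub (ρ m) (renV ρ v) k (ren (lift ρ) t)
  ren ρ (der e k t)     = der (ρ e) k (ren (lift ρ) t)

-- CtxT = general contexts C, VCtx = non-empty value contexts V.

data HSort : Set where
  tmH valH : HSort

Hole : HSort → Scope → Set
Hole tmH  Γ = Tm Γ
Hole valH Γ = Val Γ

mutual
  data CtxT (Γ : Scope) : List Kind → HSort → Set where
    hole : CtxT Γ [] tmH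
    val  : ∀ {Θ s} → VCtx Γ Θ s → CtxT Γ Θ s
    cutH : (k : Kind) → Tm (k ∷ Γ) → CtxT Γ [] valH
    cutV : ∀ {Θ s} (k : Kind) → VCtx Γ Θ s → Tm (k ∷ Γ) → CtxT Γ Θ s
    subH : Γ ∋ mul → (k : Kind) → Tm (k ∷ Γ) → CtxT Γ [] valH
    subV : ∀ {Θ s} → Γ ∋ mul → VCtx Γ Θ s → (k : Kind) → Tm (k ∷ Γ) → CtxT Γ Θ s
    cutB : ∀ {Θ s} (k : Kind) → Val Γ → CtxT (k ∷ Γ) Θ s → CtxT Γ (k ∷ Θ) s
    parB : ∀ {Θ s} → Γ ∋ mul → (k1 k2 : Kind) → CtxT (k2 ∷ k1 ∷ Γ) Θ s → CtxT Γ (k1 ∷ k2 ∷ Θ) s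
    subB : ∀ {Θ s} → Γ ∋ mul → Val Γ → (k : Kind) → CtxT (k ∷ Γ) Θ s → CtxT Γ (k ∷ Θ) s
    derB : ∀ {Θ s} → Γ ∋ exp → (k : Kind) → CtxT (k ∷ Γ) Θ s → CtxT Γ (k ∷ Θ) s

  data VCtx (Γ : Scope) : List Kind → HSort → Set where
    pairL : ∀ {Θ s} → CtxT Γ Θ s → Tm Γ → VCtx Γ Θ s
    pairR : ∀ {Θ s} → Tm Γ → CtxT Γ Θ s → VCtx Γ Θ s
    lam   : ∀ {Θ s} (k : Kind) → CtxT (k ∷ Γ) Θ s → VCtx Γ (k ∷ Θ) s
    bang  : ∀ {Θ s} → CtxT Γ Θ s → VCtx Γ Θ s

-- plain (capturing) plugging
mutual
  plug : ∀ {Γ Θ s} → CtxT Γ Θ s → Hole s (Θ ⋈ Γ) → Tm Γ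
  plug hole t              = t
  plug (val V) h           = val (plugVC V h)
  plug (cutH k b) v        = cut k v b
  plug (cutV k V b) h      = cut k (plugVC V h) b
  plug (subH m k b) v      = sub m v k b
  plug (subV m V k b) h    = sub m (plugVC V h) k b
  plug (cutB k v C) h      = cut k v (plug C h)
  plug (parB m k1 k2 C) h  = par m k1 k2 (plug C h)
  plug (subB m v k C) h    = sub m v k (plug C h)
  plug (derB e k C) h      = der e k (plug C h)

  plugVC : ∀ {Γ Θ s} → VCtx Γ Θ s → Hole s (Θ ⋈ Γ) → Val Γ
  plugVC (pairL C u) h = pair (plug C h) u
  plugVC (pairR t C) h = pair t (plug C h)
  plugVC (lam k C) h   = lam k (plug C h)
  plugVC (bang C) h    = bang (plug C h)

valHole : ∀ {Γ} s → Val Γ → Hole s Γ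
valHole tmH  v = val v
valHole valH v = v

plugV : ∀ {Γ Θ s} → CtxT Γ Θ s → Val (Θ ⋈ Γ) → Tm Γ
plugV {s = s} C v = plug C (valHole s v)

plugT : ∀ {Γ Θ} → CtxT Γ Θ tmH → Tm (Θ ⋈ Γ) → Tm Γ
plugT C t = plug C t

mutual
  renC : ∀ {Γ Δ Θ s} → Ren Γ Δ → CtxT Γ Θ s → CtxT Δ Θ s
  renC ρ hole             = hole
  renC ρ (val V)          = val (renVC ρ V)
  renC ρ (cutH k b)       = cutH k (ren (lift ρ) b)
  renC ρ (cutV k V b)     = cutV k (renVC ρ V) (ren (lift ρ) b)
  renC ρ (subH m k b)     = subH (ρ m) k (ren (lift ρ) b)
  renC ρ (subV m V k b)   = subV (ρ m) (renVC ρ V) k (ren (lift ρ) b)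
  renC ρ (cutB k v C)     = cutB k (renV ρ v) (renC (lift ρ) C)
  renC ρ (parB m k1 k2 C) = parB (ρ m) k1 k2 (renC (lift (lift ρ)) C)
  renC ρ (subB m v k C)   = subB (ρ m) (renV ρ v) k (renC (lift ρ) C)
  renC ρ (derB e k C)     = derB (ρ e) k (renC (lift ρ) C)

  renVC : ∀ {Γ Δ Θ s} → Ren Γ Δ → VCtx Γ Θ s → VCtx Δ Θ s
  renVC ρ (pairL C u) = pairL (renC ρ C) (ren ρ u)
  renVC ρ (pairR t C) = pairR (ren ρ t) (renC ρ C)
  renVC ρ (lam k C)   = lam k (renC (lift ρ) C)
  renVC ρ (bang C)    = bang (renC ρ C)

data IsL {Γ} : ∀ {Θ s} → CtxT Γ Θ s → Set where
  l-hole : IsL hole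
  l-cut  : ∀ {Θ k v} {C : CtxT (k ∷ Γ) Θ tmH} → IsL C → IsL (cutB k v C)
  l-par  : ∀ {Θ m k1 k2} {C : CtxT (k2 ∷ k1 ∷ Γ) Θ tmH} → IsL C → IsL (parB m k1 k2 C)
  l-sub  : ∀ {Θ m v k} {C : CtxT (k ∷ Γ) Θ tmH} → IsL C → IsL (subB m v k C)
  l-der  : ∀ {Θ e k} {C : CtxT (k ∷ Γ) Θ tmH} → IsL C → IsL (derB e k C)

mutual
  data IsM {Γ} : ∀ {Θ s} → CtxT Γ Θ s → Set where
    m-hole : IsM hole
    m-val  : ∀ {Θ s} {V : VCtx Γ Θ s} → IsMV V → IsM (val V)
    m-cutH : ∀ {k b} → IsM (cutH k b)
    m-cutV : ∀ {Θ s k b} {V : VCtx Γ Θ s} → IsMV V → IsM (cutV k V b)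
    m-subH : ∀ {m k b} → IsM (subH m k b)
    m-subV : ∀ {Θ s m k b} {V : VCtx Γ Θ s} → IsMV V → IsM (subV m V k b)
    m-cutB : ∀ {Θ s k v} {C : CtxT (k ∷ Γ) Θ s} → IsM C → IsM (cutB k v C)
    m-parB : ∀ {Θ s m k1 k2} {C : CtxT (k2 ∷ k1 ∷ Γ) Θ s} → IsM C → IsM (parB m k1 k2 C)
    m-subB : ∀ {Θ s m v k} {C : CtxT (k ∷ Γ) Θ s} → IsM C → IsM (subB m v k C)
    m-derB : ∀ {Θ s e k} {C : CtxT (k ∷ Γ) Θ s} → IsM C → IsM (derB e k C)

  data IsMV {Γ} : ∀ {Θ s} → VCtx Γ Θ s → Set where
    mv-pairL : ∀ {Θ s u} {C : CtxT Γ Θ s} → IsM C → IsMV (pairL C u)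
    mv-pairR : ∀ {Θ s t} {C : CtxT Γ Θ s} → IsM C → IsMV (pairR t C)
    mv-lam   : ∀ {Θ s k} {C : CtxT (k ∷ Γ) Θ s} → IsM C → IsMV (lam k C)

data OccAt {Γ Θ} : ∀ {s k} → CtxT Γ Θ s → (Θ ⋈ Γ) ∋ k → Tm Γ → Set where
  o-var : ∀ {s k} {D : CtxT Γ Θ s} {x : (Θ ⋈ Γ) ∋ k} → OccAt D x (plugV D (var x))
  o-par : ∀ {D : CtxT Γ Θ tmH} {x k1 k2 b} → OccAt D x (plugT D (par x k1 k2 b))
  o-sub : ∀ {D : CtxT Γ Θ tmH} {x v k b} → OccAt D x (plugT D (sub x v k b))
  o-der : ∀ {D : CtxT Γ Θ tmH} {x k b} → OccAt D x (plugT D (der x k b))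

-- Root rules, with the position of the step.
-- For non-(w) rules the position is cut(v, x.D) with D's hole at the
-- acted-on occurrence of x; for (w) it is the empty context.

data Root {Γ : Scope} : Tm Γ → ∀ {Θ s} → CtxT Γ Θ s → Tm Γ → Set where
  ax-m1 : ∀ {Θ s} (vm : Val Γ) → MulVal vm → (M : CtxT Γ Θ s) → IsM M →
    Root (cut mul vm (plugV (renC there M) (var (wkΘ Θ here))))
         (cutB mul vm (renC there M))
         (plugV M (renV (wkΘ Θ) vm))
  ax-m2 : ∀ {Θ s} (n : Γ ∋ mul) (t : Tm (mul ∷ Γ)) (D : CtxT (mul ∷ Γ) Θ s) →
    OccAt D (wkΘ Θ here) t →
    Root (cut mul (var n) t) (cutB mul (var n) D) (ren [ n /0] t)
  tensor : ∀ {Θ ΘL ΘL' k1 k2} (s u : Tm Γ) (M : CtxT Γ Θ tmH) → IsM M →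
    (t : Tm (k2 ∷ k1 ∷ (Θ ⋈ Γ))) →
    (L : CtxT (Θ ⋈ Γ) ΘL tmH) → IsL L → (v : Val (ΘL ⋈ (Θ ⋈ Γ))) →
    ren (wkΘ Θ) s ≡ plugV L v →
    (L' : CtxT (k1 ∷ (ΘL ⋈ (Θ ⋈ Γ))) ΘL' tmH) → IsL L' →
    (v' : Val (ΘL' ⋈ (k1 ∷ (ΘL ⋈ (Θ ⋈ Γ))))) →
    ren (there ∘ʳ (wkΘ ΘL ∘ʳ wkΘ Θ)) u ≡ plugV L' v' →
    Root (cut mul (pair s u)
            (plugT (renC there M)
               (par (wkΘ Θ here) k1 k2 (ren (lift (lift (liftΘ Θ there))) t))))
         (cutB mul (pair s u) (renC there M))
         (plugT M (plugT L (cut k1 v (plugT L'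
            (cut k2 v' (ren (lift (wkΘ ΘL' ∘ʳ lift (wkΘ ΘL))) t))))))
  lolli : ∀ {Θ ΘL ky kx} (s : Tm (ky ∷ Γ)) (M : CtxT Γ Θ tmH) → IsM M →
    (v : Val (Θ ⋈ Γ)) (t : Tm (kx ∷ (Θ ⋈ Γ))) →
    (L : CtxT (ky ∷ (Θ ⋈ Γ)) ΘL tmH) → IsL L → (v' : Val (ΘL ⋈ (ky ∷ (Θ ⋈ Γ)))) →
    ren (lift (wkΘ Θ)) s ≡ plugV L v' →
    Root (cut mul (lam ky s)
            (plugT (renC there M)
               (sub (wkΘ Θ here) (renV (liftΘ Θ there) v) kx (ren (lift (liftΘ Θ there)) t))))
         (cutB mul (lam ky s) (renC there M))
         (plugT M (cut ky v (plugT L (cut kx v' (ren (lift (wkΘ ΘL ∘ʳ there)) t)))))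
  ax-e1 : ∀ {Θ s} (ve : Val Γ) → ExpVal ve → (C : CtxT (exp ∷ Γ) Θ s) →
    Root (cut exp ve (plugV C (var (wkΘ Θ here))))
         (cutB exp ve C)
         (cut exp ve (plugV C (renV (wkΘ Θ ∘ʳ there) ve)))
  ax-e2 : ∀ {Θ k} (f : Γ ∋ exp) (C : CtxT (exp ∷ Γ) Θ tmH) (t : Tm (k ∷ (Θ ⋈ (exp ∷ Γ)))) →
    Root (cut exp (var f) (plugT C (der (wkΘ Θ here) k t)))
         (cutB exp (var f) C)
         (cut exp (var f) (plugT C (der (wkΘ Θ (there f)) k t)))
  bang-der : ∀ {Θ ΘL k} (s : Tm Γ) (C : CtxT (exp ∷ Γ) Θ tmH) (t : Tm (k ∷ (Θ ⋈ (exp ∷ Γ)))) →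
    (L : CtxT (Θ ⋈ (exp ∷ Γ)) ΘL tmH) → IsL L → (v : Val (ΘL ⋈ (Θ ⋈ (exp ∷ Γ)))) →
    ren (wkΘ Θ ∘ʳ there) s ≡ plugV L v →
    Root (cut exp (bang s) (plugT C (der (wkΘ Θ here) k t)))
         (cutB exp (bang s) C)
         (cut exp (bang s) (plugT C (plugT L (cut k v (ren (lift (wkΘ ΘL)) t)))))
  weak : (ve : Val Γ) → ExpVal ve → (t : Tm Γ) →
    Root (cut exp ve (ren there t)) hole t

mutual
  data Step {Γ : Scope} : Tm Γ → ∀ {Θ s} → CtxT Γ Θ s → Tm Γ → Set where
    root  : ∀ {Θ s t u} {P : CtxT Γ Θ s} → Root t P u → Step t P u
    valS  : ∀ {Θ s v v'} {Q : VCtx Γ Θ s} → StepV v Q v' → Step (val v) (val Q) (val v')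
    cutVS : ∀ {Θ s v v' k b} {Q : VCtx Γ Θ s} → StepV v Q v' →
            Step (cut k v b) (cutV k Q b) (cut k v' b)
    subVS : ∀ {Θ s v v' m k b} {Q : VCtx Γ Θ s} → StepV v Q v' →
            Step (sub m v k b) (subV m Q k b) (sub m v' k b)
    cutBS : ∀ {Θ s k v t t'} {P : CtxT (k ∷ Γ) Θ s} → Step t P t' →
            Step (cut k v t) (cutB k v P) (cut k v t')
    parBS : ∀ {Θ s m k1 k2 t t'} {P : CtxT (k2 ∷ k1 ∷ Γ) Θ s} → Step t P t' →
            Step (par m k1 k2 t) (parB m k1 k2 P) (par m k1 k2 t')
    subBS : ∀ {Θ s m v k t t'} {P : CtxT (k ∷ Γ) Θ s} → Step t P t' →
            Step (sub m v k t) (subB m v k P) (sub m v k t')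
    derBS : ∀ {Θ s e k t t'} {P : CtxT (k ∷ Γ) Θ s} → Step t P t' →
            Step (der e k t) (derB e k P) (der e k t')

  data StepV {Γ : Scope} : Val Γ → ∀ {Θ s} → VCtx Γ Θ s → Val Γ → Set where
    pairLS : ∀ {Θ s t t' u} {P : CtxT Γ Θ s} → Step t P t' → StepV (pair t u) (pairL P u) (pair t' u)
    pairRS : ∀ {Θ s t u u'} {P : CtxT Γ Θ s} → Step u P u' → StepV (pair t u) (pairR t P) (pair t u')
    lamS   : ∀ {Θ s k t t'} {P : CtxT (k ∷ Γ) Θ s} → Step t P t' → StepV (lam k t) (lam k P) (lam k t')
    bangS  : ∀ {Θ s t t'} {P : CtxT Γ Θ s} → Step t P t' → StepV (bang t) (bang P) (bang t')

mutual
  DFV : ∀ {Γ Θ s k} → CtxT Γ Θ s → Γ ∋ k → Set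
  DFV hole y             = ⊥
  DFV (val V) y          = DFVV V y
  DFV (cutH k b) y       = ⊥
  DFV (cutV k V b) y     = DFVV V y
  DFV (subH m k b) y     = SameVar y m
  DFV (subV m V k b) y   = SameVar y m ⊎ DFVV V y
  DFV (cutB k v C) y     = DFV C (there y)
  DFV (parB m k1 k2 C) y =
    (SameVar y m × (DFV C (there here) ⊎ DFV C here)) ⊎ DFV C (there (there y))
  DFV (subB m v k C) y   = (SameVar y m × DFV C here) ⊎ DFV C (there y)
  DFV (derB e k C) y     = (SameVar y e × DFV C here) ⊎ DFV C (there y)

  DFVV : ∀ {Γ Θ s k} → VCtx Γ Θ s → Γ ∋ k → Set
  DFVV (pairL C u) y = DFV C y
  DFVV (pairR t C) y = DFV C y
  DFVV (lam k C) y   = DFV C (there y)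
  DFVV (bang C) y    = DFV C y

mutual
  data Good {Γ} : ∀ {Θ s} → CtxT Γ Θ s → Set where
    g-hole : Good hole
    g-val  : ∀ {Θ s} {V : VCtx Γ Θ s} → GoodV V → Good (val V)
    g-par  : ∀ {Θ s m k1 k2} {C : CtxT (k2 ∷ k1 ∷ Γ) Θ s} → Good C → Good (parB m k1 k2 C)
    g-subB : ∀ {Θ s m v k} {C : CtxT (k ∷ Γ) Θ s} → Good C → Good (subB m v k C)
    g-subH : ∀ {m k b} → Good (subH m k b)
    g-subV : ∀ {Θ s m k b} {V : VCtx Γ Θ s} → GoodV V → Good (subV m V k b)
    g-der  : ∀ {Θ s e k} {C : CtxT (k ∷ Γ) Θ s} → Good C → Good (derB e k C)
    g-cut  : ∀ {Θ s k v} {C : CtxT (k ∷ Γ) Θ s} → Good C → ¬ DFV C here → Good (cutB k v C)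

  data GoodV {Γ} : ∀ {Θ s} → VCtx Γ Θ s → Set where
    gv-pairL : ∀ {Θ s u} {C : CtxT Γ Θ s} → Good C → GoodV (pairL C u)
    gv-pairR : ∀ {Θ s t} {C : CtxT Γ Θ s} → Good C → GoodV (pairR t C)
    gv-lam   : ∀ {Θ s k} {C : CtxT (k ∷ Γ) Θ s} → Good C → GoodV (lam k C)
    gv-bang  : ∀ {Θ s} {C : CtxT Γ Θ s} → Good C → GoodV (bang C)

Bad : ∀ {Γ Θ s} → CtxT Γ Θ s → Set
Bad C = ¬ Good C

GoodStep : ∀ {Γ Θ s} → Tm Γ → CtxT Γ Θ s → Tm Γ → Set
GoodStep t P u = Step t P u × Good P

module Submission where

-- Each position B⟨v⟩ of the reduct u is traced back to the redex t in one of three ways: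
--   (i)   to a position B'⟨v'⟩ of t with |v'| = |v| from which goodness is reflected, so that B' is bad when B is;
--   (ii)  v has the size of a value at a bad position of t; this covers the copies of (subterms of) the cut value,
--         which in t sits in the value position of a cut, a position that is never good;
--   (iii) B is good, being a prefix of the position of the step.
-- For bad B only (i) and (ii) remain. At the root the reduct has the
-- form F⟨X⟩, where F is the context around the acted-on occurrence and is good because the step is; the tracing
-- of X is transported through F. Along the way one must track dominating variables, since goodness of
-- cut(v, x.G) asks that x not dominate G; for the fired cut this holds because the step is good.

open import Defs
open import Data.List using (List)
open import Data.Product using (Σ; _×_)
open import Relation.Binary.PropositionalEquality using (_≡_)
open import Data.List using ([]; _∷_)
open import Data.Product using (_,_; proj₁) renaming (map₁ to ×-map₁; map₂ to ×-map₂)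
open import Data.Sum using (_⊎_; inj₁; inj₂) renaming (map to ⊎-map; map₂ to ⊎-map₂)
open import Data.Maybe using (Maybe; just; nothing) renaming (map to maybe-map)
open import Data.Nat using (ℕ; suc; _+_)
open import Data.Nat.Properties using (suc-injective)
open import Data.Empty using (⊥; ⊥-elim)
open import Data.Unit using (⊤; tt)
open import Function using (id)
open import Relation.Nullary using (¬_)
open import Relation.Binary.PropositionalEquality using (refl; sym; trans; cong; cong₂; subst)

idx-injective : ∀ {Γ k k'} (x : Γ ∋ k) (y : Γ ∋ k') → idx x ≡ idx y → Σ (k ≡ k') λ { refl → x ≡ y }
idx-injective here      here      e = refl , refl
idx-injective (there x) (there y) e with idx-injective x y (suc-injective e)
... | refl , refl = refl , refl

SameVar-ren : ∀ {Γ Δ k k'} (ρ : Ren Γ Δ) (x : Γ ∋ k) (y : Γ ∋ k') → SameVar x y → SameVar (ρ x) (ρ y)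
SameVar-ren ρ x y e with idx-injective x y e
... | refl , refl = refl

renHole : ∀ {Γ Δ} s → Ren Γ Δ → Hole s Γ → Hole s Δ
renHole tmH  ρ t = ren ρ t
renHole valH ρ v = renV ρ v

renHole-valHole : ∀ {Γ Δ} s (ρ : Ren Γ Δ) (v : Val Γ) → renHole s ρ (valHole s v) ≡ valHole s (renV ρ v)
renHole-valHole tmH  ρ v = refl
renHole-valHole valH ρ v = refl

mutual
  ren-plug : ∀ {Γ Δ Θ s} (ρ : Ren Γ Δ) (C : CtxT Γ Θ s) (h : Hole s (Θ ⋈ Γ)) →
    ren ρ (plug C h) ≡ plug (renC ρ C) (renHole s (liftΘ Θ ρ) h)
  ren-plug ρ hole             h = refl
  ren-plug ρ (val V)          h = cong val (renV-plugVC ρ V h)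
  ren-plug ρ (cutH k b)       h = refl
  ren-plug ρ (cutV k V b)     h = cong (λ z → cut k z (ren (lift ρ) b)) (renV-plugVC ρ V h)
  ren-plug ρ (subH m k b)     h = refl
  ren-plug ρ (subV m V k b)   h = cong (λ z → sub (ρ m) z k (ren (lift ρ) b)) (renV-plugVC ρ V h)
  ren-plug ρ (cutB k v C)     h = cong (cut k (renV ρ v)) (ren-plug (lift ρ) C h)
  ren-plug ρ (parB m k1 k2 C) h = cong (par (ρ m) k1 k2) (ren-plug (lift (lift ρ)) C h)
  ren-plug ρ (subB m v k C)   h = cong (sub (ρ m) (renV ρ v) k) (ren-plug (lift ρ) C h)
  ren-plug ρ (derB e k C)     h = cong (der (ρ e) k) (ren-plug (lift ρ) C h)

  renV-plugVC : ∀ {Γ Δ Θ s} (ρ : Ren Γ Δ) (V : VCtx Γ Θ s) (h : Hole s (Θ ⋈ Γ)) →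
    renV ρ (plugVC V h) ≡ plugVC (renVC ρ V) (renHole s (liftΘ Θ ρ) h)
  renV-plugVC ρ (pairL C u) h = cong (λ z → pair z (ren ρ u)) (ren-plug ρ C h)
  renV-plugVC ρ (pairR t C) h = cong (pair (ren ρ t)) (ren-plug ρ C h)
  renV-plugVC ρ (lam k C)   h = cong (lam k) (ren-plug (lift ρ) C h)
  renV-plugVC ρ (bang C)    h = cong bang (ren-plug ρ C h)

ren-plugV : ∀ {Γ Δ Θ s} (ρ : Ren Γ Δ) (C : CtxT Γ Θ s) (v : Val (Θ ⋈ Γ)) →
  ren ρ (plugV C v) ≡ plugV (renC ρ C) (renV (liftΘ Θ ρ) v)
ren-plugV {s = s} ρ C v = trans (ren-plug ρ C (valHole s v)) (cong (plug (renC ρ C)) (renHole-valHole s _ v))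

renV-plugVC-valHole : ∀ {Γ Δ Θ s} (ρ : Ren Γ Δ) (V : VCtx Γ Θ s) (v : Val (Θ ⋈ Γ)) →
  renV ρ (plugVC V (valHole s v)) ≡ plugVC (renVC ρ V) (valHole s (renV (liftΘ Θ ρ) v))
renV-plugVC-valHole {s = s} ρ V v =
  trans (renV-plugVC ρ V (valHole s v)) (cong (plugVC (renVC ρ V)) (renHole-valHole s _ v))

mutual
  sizeV-ren : ∀ {Γ Δ} (ρ : Ren Γ Δ) (v : Val Γ) → sizeV (renV ρ v) ≡ sizeV v
  sizeV-ren ρ (var x)    = refl
  sizeV-ren ρ (pair t s) = cong suc (cong₂ _+_ (size-ren ρ t) (size-ren ρ s))
  sizeV-ren ρ (lam k t)  = cong suc (size-ren (lift ρ) t)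
  sizeV-ren ρ (bang t)   = cong suc (size-ren ρ t)

  size-ren : ∀ {Γ Δ} (ρ : Ren Γ Δ) (t : Tm Γ) → size (ren ρ t) ≡ size t
  size-ren ρ (val v)         = sizeV-ren ρ v
  size-ren ρ (cut k v t)     = cong suc (cong₂ _+_ (sizeV-ren ρ v) (size-ren (lift ρ) t))
  size-ren ρ (par m k1 k2 t) = cong suc (size-ren (lift (lift ρ)) t)
  size-ren ρ (sub m v k t)   = cong suc (cong₂ _+_ (sizeV-ren ρ v) (size-ren (lift ρ) t))
  size-ren ρ (der e k t)     = cong suc (size-ren (lift ρ) t)

idRen : ∀ {Γ} → Ren Γ Γ
idRen x = x

IsIdentity : ∀ {Γ} → Ren Γ Γ → Set
IsIdentity {Γ} ρ = ∀ {k} (x : Γ ∋ k) → ρ x ≡ x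

lift-id : ∀ {Γ k'} (ρ : Ren Γ Γ) → IsIdentity ρ → IsIdentity (lift {k = k'} ρ)
lift-id ρ h here      = refl
lift-id ρ h (there x) = cong there (h x)

liftΘ-id : ∀ {Γ} Θ (ρ : Ren Γ Γ) → IsIdentity ρ → IsIdentity (liftΘ Θ ρ)
liftΘ-id []      ρ h = h
liftΘ-id (k ∷ Θ) ρ h = liftΘ-id Θ (lift ρ) (lift-id ρ h)

mutual
  ren-id : ∀ {Γ} (ρ : Ren Γ Γ) → IsIdentity ρ → (t : Tm Γ) → ren ρ t ≡ t
  ren-id ρ h (val v)         = cong val (renV-id ρ h v)
  ren-id ρ h (cut k v t)     = cong₂ (cut k) (renV-id ρ h v) (ren-id (lift ρ) (lift-id ρ h) t)
  ren-id ρ h (par m k1 k2 t) rewrite h m = cong (par m k1 k2) (ren-id (lift (lift ρ)) (lift-id (lift ρ) (lift-id ρ h)) t)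
  ren-id ρ h (sub m v k t)   rewrite h m = cong₂ (λ w b → sub m w k b) (renV-id ρ h v) (ren-id (lift ρ) (lift-id ρ h) t)
  ren-id ρ h (der e k t)     rewrite h e = cong (der e k) (ren-id (lift ρ) (lift-id ρ h) t)

  renV-id : ∀ {Γ} (ρ : Ren Γ Γ) → IsIdentity ρ → (v : Val Γ) → renV ρ v ≡ v
  renV-id ρ h (var x)    = cong var (h x)
  renV-id ρ h (pair t s) = cong₂ pair (ren-id ρ h t) (ren-id ρ h s)
  renV-id ρ h (lam k t)  = cong (lam k) (ren-id (lift ρ) (lift-id ρ h) t)
  renV-id ρ h (bang t)   = cong bang (ren-id ρ h t)

mutual
  renC-id : ∀ {Γ Θ s} (ρ : Ren Γ Γ) → IsIdentity ρ → (C : CtxT Γ Θ s) → renC ρ C ≡ C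
  renC-id ρ h hole             = refl
  renC-id ρ h (val V)          = cong val (renVC-id ρ h V)
  renC-id ρ h (cutH k b)       = cong (cutH k) (ren-id (lift ρ) (lift-id ρ h) b)
  renC-id ρ h (cutV k V b)     = cong₂ (cutV k) (renVC-id ρ h V) (ren-id (lift ρ) (lift-id ρ h) b)
  renC-id ρ h (subH m k b)     rewrite h m = cong (subH m k) (ren-id (lift ρ) (lift-id ρ h) b)
  renC-id ρ h (subV m V k b)   rewrite h m = cong₂ (λ W b' → subV m W k b') (renVC-id ρ h V) (ren-id (lift ρ) (lift-id ρ h) b)
  renC-id ρ h (cutB k v C)     = cong₂ (cutB k) (renV-id ρ h v) (renC-id (lift ρ) (lift-id ρ h) C)
  renC-id ρ h (parB m k1 k2 C) rewrite h m = cong (parB m k1 k2) (renC-id (lift (lift ρ)) (lift-id (lift ρ) (lift-id ρ h)) C)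
  renC-id ρ h (subB m v k C)   rewrite h m = cong₂ (λ w C' → subB m w k C') (renV-id ρ h v) (renC-id (lift ρ) (lift-id ρ h) C)
  renC-id ρ h (derB e k C)     rewrite h e = cong (derB e k) (renC-id (lift ρ) (lift-id ρ h) C)

  renVC-id : ∀ {Γ Θ s} (ρ : Ren Γ Γ) → IsIdentity ρ → (V : VCtx Γ Θ s) → renVC ρ V ≡ V
  renVC-id ρ h (pairL C u) = cong₂ pairL (renC-id ρ h C) (ren-id ρ h u)
  renVC-id ρ h (pairR t C) = cong₂ pairR (ren-id ρ h t) (renC-id ρ h C)
  renVC-id ρ h (lam k C)   = cong (lam k) (renC-id (lift ρ) (lift-id ρ h) C)
  renVC-id ρ h (bang C)    = cong bang (renC-id ρ h C)

val-injective : ∀ {Γ} {a b : Val Γ} → val a ≡ val b → a ≡ b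
val-injective refl = refl

cut-injective : ∀ {Γ k k' a a'} {b : Tm (k ∷ Γ)} {b' : Tm (k' ∷ Γ)} → cut k a b ≡ cut k' a' b' →
  Σ (k ≡ k') λ { refl → a ≡ a' × b ≡ b' }
cut-injective refl = refl , refl , refl

sub-injective : ∀ {Γ k k' m m' a a'} {b : Tm (k ∷ Γ)} {b' : Tm (k' ∷ Γ)} → sub m a k b ≡ sub m' a' k' b' →
  Σ (k ≡ k') λ { refl → m ≡ m' × a ≡ a' × b ≡ b' }
sub-injective refl = refl , refl , refl , refl

par-injective : ∀ {Γ k1 k2 k1' k2' m m'} {b : Tm (k2 ∷ k1 ∷ Γ)} {b' : Tm (k2' ∷ k1' ∷ Γ)} →
  par m k1 k2 b ≡ par m' k1' k2' b' → Σ (k1 ≡ k1') λ { refl → Σ (k2 ≡ k2') λ { refl → m ≡ m' × b ≡ b' } }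
par-injective refl = refl , refl , refl , refl

der-injective : ∀ {Γ k k' m m'} {b : Tm (k ∷ Γ)} {b' : Tm (k' ∷ Γ)} → der m k b ≡ der m' k' b' →
  Σ (k ≡ k') λ { refl → m ≡ m' × b ≡ b' }
der-injective refl = refl , refl , refl

pair-injective : ∀ {Γ} {a b a' b' : Tm Γ} → pair a b ≡ pair a' b' → a ≡ a' × b ≡ b'
pair-injective refl = refl , refl

lam-injective : ∀ {Γ k k'} {b : Tm (k ∷ Γ)} {b' : Tm (k' ∷ Γ)} → lam k b ≡ lam k' b' → Σ (k ≡ k') λ { refl → b ≡ b' }
lam-injective refl = refl , refl

bang-injective : ∀ {Γ} {a b : Tm Γ} → bang a ≡ bang b → a ≡ b
bang-injective refl = refl

RenamedPosition : ∀ {Γ Δ Θ σ} → Ren Γ Δ → Tm Γ → CtxT Δ Θ σ → Val (Θ ⋈ Δ) → Set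
RenamedPosition {Γ} {Θ = Θ} {σ} ρ S B v = Σ (CtxT Γ Θ σ) λ B₀ → Σ (Val (Θ ⋈ Γ)) λ v₀ →
  S ≡ plugV B₀ v₀ × B ≡ renC ρ B₀ × v ≡ renV (liftΘ Θ ρ) v₀

RenamedPositionV : ∀ {Γ Δ Θ σ} → Ren Γ Δ → Val Γ → VCtx Δ Θ σ → Val (Θ ⋈ Δ) → Set
RenamedPositionV {Γ} {Θ = Θ} {σ} ρ S B v = Σ (VCtx Γ Θ σ) λ B₀ → Σ (Val (Θ ⋈ Γ)) λ v₀ →
  S ≡ plugVC B₀ (valHole σ v₀) × B ≡ renVC ρ B₀ × v ≡ renV (liftΘ Θ ρ) v₀

mutual
  ren-plugV⁻ : ∀ {Γ Δ Θ σ} (ρ : Ren Γ Δ) (S : Tm Γ) (B : CtxT Δ Θ σ) (v : Val (Θ ⋈ Δ)) →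
    ren ρ S ≡ plugV B v → RenamedPosition ρ S B v
  ren-plugV⁻ ρ (val w) hole v refl = hole , w , refl , refl , refl
  ren-plugV⁻ ρ (val w) (val V) v e with renV-plugVC⁻ ρ w V v (val-injective e)
  ... | V₀ , v₀ , refl , refl , refl = val V₀ , v₀ , refl , refl , refl
  ren-plugV⁻ ρ (cut k w S) (cutH .k b) v refl = cutH k S , w , refl , refl , refl
  ren-plugV⁻ ρ (cut k w S) (cutV k' V b) v e with cut-injective e
  ... | refl , e₁ , refl with renV-plugVC⁻ ρ w V v e₁
  ... | V₀ , v₀ , refl , refl , refl = cutV k V₀ S , v₀ , refl , refl , refl
  ren-plugV⁻ ρ (cut k w S) (cutB k' w' B) v e with cut-injective e
  ... | refl , refl , e₂ with ren-plugV⁻ (lift ρ) S B v e₂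
  ... | B₀ , v₀ , refl , refl , refl = cutB k w B₀ , v₀ , refl , refl , refl
  ren-plugV⁻ ρ (sub m w k S) (subH .(ρ m) .k b) v refl = subH m k S , w , refl , refl , refl
  ren-plugV⁻ ρ (sub m w k S) (subV m' V k' b) v e with sub-injective e
  ... | refl , refl , e₁ , refl with renV-plugVC⁻ ρ w V v e₁
  ... | V₀ , v₀ , refl , refl , refl = subV m V₀ k S , v₀ , refl , refl , refl
  ren-plugV⁻ ρ (sub m w k S) (subB m' w' k' B) v e with sub-injective e
  ... | refl , refl , refl , e₂ with ren-plugV⁻ (lift ρ) S B v e₂
  ... | B₀ , v₀ , refl , refl , refl = subB m w k B₀ , v₀ , refl , refl , refl
  ren-plugV⁻ ρ (par m k1 k2 S) (parB m' k1' k2' B) v e with par-injective e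
  ... | refl , refl , refl , e₂ with ren-plugV⁻ (lift (lift ρ)) S B v e₂
  ... | B₀ , v₀ , refl , refl , refl = parB m k1 k2 B₀ , v₀ , refl , refl , refl
  ren-plugV⁻ ρ (der m k S) (derB m' k' B) v e with der-injective e
  ... | refl , refl , e₂ with ren-plugV⁻ (lift ρ) S B v e₂
  ... | B₀ , v₀ , refl , refl , refl = derB m k B₀ , v₀ , refl , refl , refl

  renV-plugVC⁻ : ∀ {Γ Δ Θ σ} (ρ : Ren Γ Δ) (S : Val Γ) (B : VCtx Δ Θ σ) (v : Val (Θ ⋈ Δ)) →
    renV ρ S ≡ plugVC B (valHole σ v) → RenamedPositionV ρ S B v
  renV-plugVC⁻ ρ (pair a b) (pairL C u) v e with pair-injective e
  ... | e₁ , refl with ren-plugV⁻ ρ a C v e₁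
  ... | B₀ , v₀ , refl , refl , refl = pairL B₀ b , v₀ , refl , refl , refl
  renV-plugVC⁻ ρ (pair a b) (pairR t C) v e with pair-injective e
  ... | refl , e₂ with ren-plugV⁻ ρ b C v e₂
  ... | B₀ , v₀ , refl , refl , refl = pairR a B₀ , v₀ , refl , refl , refl
  renV-plugVC⁻ ρ (lam k a) (lam k' C) v e with lam-injective e
  ... | refl , e₁ with ren-plugV⁻ (lift ρ) a C v e₁
  ... | B₀ , v₀ , refl , refl , refl = lam k B₀ , v₀ , refl , refl , refl
  renV-plugVC⁻ ρ (bang a) (bang C) v e with ren-plugV⁻ ρ a C v (bang-injective e)
  ... | B₀ , v₀ , refl , refl , refl = bang B₀ , v₀ , refl , refl , refl

mutual
  DFV-ren : ∀ {Γ Δ Θ s k} (ρ : Ren Γ Δ) (C : CtxT Γ Θ s) (y : Γ ∋ k) → DFV C y → DFV (renC ρ C) (ρ y)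
  DFV-ren ρ (val V)          y d        = DFVV-ren ρ V y d
  DFV-ren ρ (cutV k V b)     y d        = DFVV-ren ρ V y d
  DFV-ren ρ (subH m k b)     y d        = SameVar-ren ρ y m d
  DFV-ren ρ (subV m V k b)   y d        = ⊎-map (SameVar-ren ρ y m) (DFVV-ren ρ V y) d
  DFV-ren ρ (cutB k v C)     y d        = DFV-ren (lift ρ) C (there y) d
  DFV-ren ρ (parB m k1 k2 C) y (inj₁ (e , d)) =
    inj₁ (SameVar-ren ρ y m e , ⊎-map (DFV-ren (lift (lift ρ)) C (there here)) (DFV-ren (lift (lift ρ)) C here) d)
  DFV-ren ρ (parB m k1 k2 C) y (inj₂ d) = inj₂ (DFV-ren (lift (lift ρ)) C (there (there y)) d)
  DFV-ren ρ (subB m v k C)   y d        = ⊎-map (λ (e , d) → SameVar-ren ρ y m e , DFV-ren (lift ρ) C here d)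
                                                 (DFV-ren (lift ρ) C (there y)) d
  DFV-ren ρ (derB e k C)     y d        = ⊎-map (λ (e' , d) → SameVar-ren ρ y e e' , DFV-ren (lift ρ) C here d)
                                                 (DFV-ren (lift ρ) C (there y)) d

  DFVV-ren : ∀ {Γ Δ Θ s k} (ρ : Ren Γ Δ) (V : VCtx Γ Θ s) (y : Γ ∋ k) → DFVV V y → DFVV (renVC ρ V) (ρ y)
  DFVV-ren ρ (pairL C u) y d = DFV-ren ρ C y d
  DFVV-ren ρ (pairR t C) y d = DFV-ren ρ C y d
  DFVV-ren ρ (lam k C)   y d = DFV-ren (lift ρ) C (there y) d
  DFVV-ren ρ (bang C)    y d = DFV-ren ρ C y d

DFVPreimage : ∀ {Γ Δ Θ s k} → Ren Γ Δ → CtxT Γ Θ s → Δ ∋ k → Set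
DFVPreimage {Γ} ρ C y = Σ Kind λ k' → Σ (Γ ∋ k') λ x → DFV C x × SameVar (ρ x) y

DFVVPreimage : ∀ {Γ Δ Θ s k} → Ren Γ Δ → VCtx Γ Θ s → Δ ∋ k → Set
DFVVPreimage {Γ} ρ C y = Σ Kind λ k' → Σ (Γ ∋ k') λ x → DFVV C x × SameVar (ρ x) y

preimage-here : ∀ {Γ Δ Θ s k} (ρ : Ren Γ Δ) (C : CtxT (k ∷ Γ) Θ s) → DFVPreimage (lift ρ) C (here {k = k}) → DFV C here
preimage-here ρ C (_ , here , d , e) = d

preimage-there : ∀ {Γ Δ Θ s k k'} (ρ : Ren Γ Δ) (C : CtxT (k' ∷ Γ) Θ s) (y : Δ ∋ k) →
  DFVPreimage (lift ρ) C (there y) → Σ Kind λ k'' → Σ (Γ ∋ k'') λ x → DFV C (there x) × SameVar (ρ x) y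
preimage-there ρ C y (_ , there x , d , e) = _ , x , d , suc-injective e

preimage-there-here : ∀ {Γ Δ Θ s k1 k2} (ρ : Ren Γ Δ) (C : CtxT (k2 ∷ k1 ∷ Γ) Θ s) →
  DFVPreimage (lift (lift ρ)) C (there (here {k = k1})) → DFV C (there here)
preimage-there-here ρ C (_ , there here , d , e) = d

preimage-there-there : ∀ {Γ Δ Θ s k k1 k2} (ρ : Ren Γ Δ) (C : CtxT (k2 ∷ k1 ∷ Γ) Θ s) (y : Δ ∋ k) →
  DFVPreimage (lift (lift ρ)) C (there (there y)) →
  Σ Kind λ k'' → Σ (Γ ∋ k'') λ x → DFV C (there (there x)) × SameVar (ρ x) y
preimage-there-there ρ C y (_ , there (there x) , d , e) = _ , x , d , suc-injective (suc-injective e)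

mutual
  DFV-ren⁻ : ∀ {Γ Δ Θ s k} (ρ : Ren Γ Δ) (C : CtxT Γ Θ s) (y : Δ ∋ k) → DFV (renC ρ C) y → DFVPreimage ρ C y
  DFV-ren⁻ ρ (val V)          y d        = DFVV-ren⁻ ρ V y d
  DFV-ren⁻ ρ (cutV k V b)     y d        = DFVV-ren⁻ ρ V y d
  DFV-ren⁻ ρ (subH m k b)     y d        = _ , m , refl , sym d
  DFV-ren⁻ ρ (subV m V k b)   y (inj₁ d) = _ , m , inj₁ refl , sym d
  DFV-ren⁻ ρ (subV m V k b)   y (inj₂ d) with DFVV-ren⁻ ρ V y d
  ... | _ , x , d' , e = _ , x , inj₂ d' , e
  DFV-ren⁻ ρ (cutB k v C)     y d        = preimage-there ρ C y (DFV-ren⁻ (lift ρ) C (there y) d)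
  DFV-ren⁻ ρ (parB m k1 k2 C) y (inj₁ (e , inj₁ d)) =
    _ , m , inj₁ (refl , inj₁ (preimage-there-here ρ C (DFV-ren⁻ (lift (lift ρ)) C (there here) d))) , sym e
  DFV-ren⁻ ρ (parB m k1 k2 C) y (inj₁ (e , inj₂ d)) =
    _ , m , inj₁ (refl , inj₂ (preimage-here (lift ρ) C (DFV-ren⁻ (lift (lift ρ)) C here d))) , sym e
  DFV-ren⁻ ρ (parB m k1 k2 C) y (inj₂ d) with preimage-there-there ρ C y (DFV-ren⁻ (lift (lift ρ)) C (there (there y)) d)
  ... | _ , x , d' , e = _ , x , inj₂ d' , e
  DFV-ren⁻ ρ (subB m v k C)   y (inj₁ (e , d)) = _ , m , inj₁ (refl , preimage-here ρ C (DFV-ren⁻ (lift ρ) C here d)) , sym e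
  DFV-ren⁻ ρ (subB m v k C)   y (inj₂ d) with preimage-there ρ C y (DFV-ren⁻ (lift ρ) C (there y) d)
  ... | _ , x , d' , e = _ , x , inj₂ d' , e
  DFV-ren⁻ ρ (derB m k C)     y (inj₁ (e , d)) = _ , m , inj₁ (refl , preimage-here ρ C (DFV-ren⁻ (lift ρ) C here d)) , sym e
  DFV-ren⁻ ρ (derB m k C)     y (inj₂ d) with preimage-there ρ C y (DFV-ren⁻ (lift ρ) C (there y) d)
  ... | _ , x , d' , e = _ , x , inj₂ d' , e

  DFVV-ren⁻ : ∀ {Γ Δ Θ s k} (ρ : Ren Γ Δ) (V : VCtx Γ Θ s) (y : Δ ∋ k) → DFVV (renVC ρ V) y → DFVVPreimage ρ V y
  DFVV-ren⁻ ρ (pairL C u) y d = DFV-ren⁻ ρ C y d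
  DFVV-ren⁻ ρ (pairR t C) y d = DFV-ren⁻ ρ C y d
  DFVV-ren⁻ ρ (lam k C)   y d = preimage-there ρ C y (DFV-ren⁻ (lift ρ) C (there y) d)
  DFVV-ren⁻ ρ (bang C)    y d = DFV-ren⁻ ρ C y d

mutual
  good-ren : ∀ {Γ Δ Θ s} (ρ : Ren Γ Δ) (C : CtxT Γ Θ s) → Good C → Good (renC ρ C)
  good-ren ρ hole             g-hole       = g-hole
  good-ren ρ (val V)          (g-val g)    = g-val (goodV-ren ρ V g)
  good-ren ρ (subH m k b)     g-subH       = g-subH
  good-ren ρ (subV m V k b)   (g-subV g)   = g-subV (goodV-ren ρ V g)
  good-ren ρ (cutB k v C)     (g-cut g n)  =
    g-cut (good-ren (lift ρ) C g) (λ d → n (preimage-here ρ C (DFV-ren⁻ (lift ρ) C here d)))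
  good-ren ρ (parB m k1 k2 C) (g-par g)    = g-par (good-ren _ C g)
  good-ren ρ (subB m v k C)   (g-subB g)   = g-subB (good-ren _ C g)
  good-ren ρ (derB e k C)     (g-der g)    = g-der (good-ren _ C g)

  goodV-ren : ∀ {Γ Δ Θ s} (ρ : Ren Γ Δ) (V : VCtx Γ Θ s) → GoodV V → GoodV (renVC ρ V)
  goodV-ren ρ (pairL C u) (gv-pairL g) = gv-pairL (good-ren ρ C g)
  goodV-ren ρ (pairR t C) (gv-pairR g) = gv-pairR (good-ren ρ C g)
  goodV-ren ρ (lam k C)   (gv-lam g)   = gv-lam (good-ren _ C g)
  goodV-ren ρ (bang C)    (gv-bang g)  = gv-bang (good-ren ρ C g)

mutual
  good-ren⁻ : ∀ {Γ Δ Θ s} (ρ : Ren Γ Δ) (C : CtxT Γ Θ s) → Good (renC ρ C) → Good C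
  good-ren⁻ ρ hole             g-hole      = g-hole
  good-ren⁻ ρ (val V)          (g-val g)   = g-val (goodV-ren⁻ ρ V g)
  good-ren⁻ ρ (subH m k b)     g-subH      = g-subH
  good-ren⁻ ρ (subV m V k b)   (g-subV g)  = g-subV (goodV-ren⁻ ρ V g)
  good-ren⁻ ρ (cutB k v C)     (g-cut g n) = g-cut (good-ren⁻ (lift ρ) C g) (λ d → n (DFV-ren (lift ρ) C here d))
  good-ren⁻ ρ (parB m k1 k2 C) (g-par g)   = g-par (good-ren⁻ _ C g)
  good-ren⁻ ρ (subB m v k C)   (g-subB g)  = g-subB (good-ren⁻ _ C g)
  good-ren⁻ ρ (derB e k C)     (g-der g)   = g-der (good-ren⁻ _ C g)

  goodV-ren⁻ : ∀ {Γ Δ Θ s} (ρ : Ren Γ Δ) (V : VCtx Γ Θ s) → GoodV (renVC ρ V) → GoodV V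
  goodV-ren⁻ ρ (pairL C u) (gv-pairL g) = gv-pairL (good-ren⁻ ρ C g)
  goodV-ren⁻ ρ (pairR t C) (gv-pairR g) = gv-pairR (good-ren⁻ ρ C g)
  goodV-ren⁻ ρ (lam k C)   (gv-lam g)   = gv-lam (good-ren⁻ _ C g)
  goodV-ren⁻ ρ (bang C)    (gv-bang g)  = gv-bang (good-ren⁻ ρ C g)

-- Tracing positions of the reduct back to the redex

PartialRen : Scope → Scope → Set
PartialRen Γ Δ = ∀ {k} → Γ ∋ k → Maybe (Δ ∋ k)

total : ∀ {Γ Δ} → Ren Γ Δ → PartialRen Γ Δ
total ρ x = just (ρ x)

extNothing : ∀ {Γ Δ k'} → PartialRen Γ Δ → PartialRen (k' ∷ Γ) Δ
extNothing φ here      = nothing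
extNothing φ (there x) = φ x

extNothingΘ : ∀ {Γ Δ} Θ → PartialRen Γ Δ → PartialRen (Θ ⋈ Γ) Δ
extNothingΘ []      φ = φ
extNothingΘ (k ∷ Θ) φ = extNothingΘ Θ (extNothing φ)

extNothingΘ-wk : ∀ {Γ Δ k} Θ (φ : PartialRen Γ Δ) (x : Γ ∋ k) → extNothingΘ Θ φ (wkΘ Θ x) ≡ φ x
extNothingΘ-wk []      φ x = refl
extNothingΘ-wk (k ∷ Θ) φ x = extNothingΘ-wk Θ (extNothing φ) (there x)

consPartial : ∀ {Γ Δ k} → Δ ∋ k → PartialRen Γ Δ → PartialRen (k ∷ Γ) Δ
consPartial y φ here      = just y
consPartial y φ (there z) = φ z

VarPred : Scope → Set₁
VarPred Γ = ∀ {k} → Γ ∋ k → Set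

Blocked : Scope → Set₁
Blocked = VarPred

noneBlocked : ∀ {Γ} → Blocked Γ
noneBlocked x = ⊥

hereBlocked : ∀ {Γ k'} → Blocked (k' ∷ Γ)
hereBlocked here      = ⊤
hereBlocked (there x) = ⊥

liftBlocked : ∀ {Δ k'} → Blocked Δ → Blocked (k' ∷ Δ)
liftBlocked Bl here      = ⊥
liftBlocked Bl (there x) = Bl x

liftBlockedΘ : ∀ {Δ} Θ → Blocked Δ → Blocked (Θ ⋈ Δ)
liftBlockedΘ []      Bl = Bl
liftBlockedΘ (k ∷ Θ) Bl = liftBlockedΘ Θ (liftBlocked Bl)

liftBlockedΘ-wk : ∀ {Δ k} Θ (Bl : Blocked Δ) (x : Δ ∋ k) → Bl x → liftBlockedΘ Θ Bl (wkΘ Θ x)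
liftBlockedΘ-wk []      Bl x b = b
liftBlockedΘ-wk (k ∷ Θ) Bl x b = liftBlockedΘ-wk Θ (liftBlocked Bl) (there x) b

-- If the variable bound by der(e, x.·), sub(e, v, x.·) or par(e, x.y.·) dominates, so does e: it is blocked when e is.
blockedLike : ∀ {Δ kk k'} → Δ ∋ kk → Blocked Δ → Blocked (k' ∷ Δ)
blockedLike x Bl here      = Bl x
blockedLike x Bl (there y) = Bl y

blockedLike² : ∀ {Δ kk k1 k2} → Δ ∋ kk → Blocked Δ → Blocked (k2 ∷ k1 ∷ Δ)
blockedLike² x Bl here              = Bl x
blockedLike² x Bl (there here)      = Bl x
blockedLike² x Bl (there (there y)) = Bl y

MaybeDFV : ∀ {Δ Θ s k} → CtxT Δ Θ s → Maybe (Δ ∋ k) → Set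
MaybeDFV C nothing  = ⊥
MaybeDFV C (just x) = DFV C x

MaybeDFVV : ∀ {Δ Θ s k} → VCtx Δ Θ s → Maybe (Δ ∋ k) → Set
MaybeDFVV C nothing  = ⊥
MaybeDFVV C (just x) = DFVV C x

Undominated : ∀ {Δ Θ s} → Blocked Δ → CtxT Δ Θ s → Set
Undominated {Δ} Bl C = ∀ {k} (x : Δ ∋ k) → Bl x → ¬ DFV C x

UndominatedV : ∀ {Δ Θ s} → Blocked Δ → VCtx Δ Θ s → Set
UndominatedV {Δ} Bl C = ∀ {k} (x : Δ ∋ k) → Bl x → ¬ DFVV C x

GoodWithin : ∀ {Γ Θ σ} → VarPred Γ → CtxT Γ Θ σ → Set
GoodWithin {Γ} P B = Good B × (∀ {k} (z : Γ ∋ k) → DFV B z → P z)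

GoodWithinV : ∀ {Γ Θ σ} → VarPred Γ → VCtx Γ Θ σ → Set
GoodWithinV {Γ} P B = GoodV B × (∀ {k} (z : Γ ∋ k) → DFVV B z → P z)

module _ {Γ : Scope} where

  GoodWithin-mono : ∀ {Θ σ} {P Q : VarPred Γ} {B : CtxT Γ Θ σ} →
    (∀ {k} {z : Γ ∋ k} → P z → Q z) → GoodWithin P B → GoodWithin Q B
  GoodWithin-mono f (g , p) = g , λ z d → f (p z d)

  GoodWithin-hole : ∀ {P : VarPred Γ} → GoodWithin P hole
  GoodWithin-hole = g-hole , λ z ()

  GoodWithin-val : ∀ {Θ σ} {P : VarPred Γ} {V : VCtx Γ Θ σ} → GoodWithinV P V → GoodWithin P (val V)
  GoodWithin-val (g , p) = g-val g , p

  GoodWithin-subH : ∀ {m : Γ ∋ mul} {k b} → GoodWithin (λ z → SameVar z m) (subH m k b)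
  GoodWithin-subH = g-subH , λ z d → d

  GoodWithin-subV : ∀ {Θ σ m k b} {P : VarPred Γ} {V : VCtx Γ Θ σ} →
    GoodWithinV P V → GoodWithin (λ z → SameVar z m ⊎ P z) (subV m V k b)
  GoodWithin-subV (g , p) = g-subV g , λ z → ⊎-map₂ (p z)

  GoodWithin-cut : ∀ {Θ σ k w} {P : VarPred (k ∷ Γ)} {C : CtxT (k ∷ Γ) Θ σ} →
    ¬ P here → GoodWithin P C → GoodWithin (λ z → P (there z)) (cutB k w C)
  GoodWithin-cut n (g , p) = g-cut g (λ d → n (p here d)) , λ z → p (there z)

  GoodWithin-par : ∀ {Θ σ m k1 k2} {P : VarPred (k2 ∷ k1 ∷ Γ)} {C : CtxT (k2 ∷ k1 ∷ Γ) Θ σ} → GoodWithin P C →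
    GoodWithin (λ z → (SameVar z m × (P (there here) ⊎ P here)) ⊎ P (there (there z))) (parB m k1 k2 C)
  GoodWithin-par (g , p) = g-par g , λ z → ⊎-map (×-map₂ (⊎-map (p _) (p _))) (p _)

  GoodWithin-sub : ∀ {Θ σ m w k} {P : VarPred (k ∷ Γ)} {C : CtxT (k ∷ Γ) Θ σ} → GoodWithin P C →
    GoodWithin (λ z → (SameVar z m × P here) ⊎ P (there z)) (subB m w k C)
  GoodWithin-sub (g , p) = g-subB g , λ z → ⊎-map (×-map₂ (p _)) (p _)

  GoodWithin-der : ∀ {Θ σ e k} {P : VarPred (k ∷ Γ)} {C : CtxT (k ∷ Γ) Θ σ} → GoodWithin P C →
    GoodWithin (λ z → (SameVar z e × P here) ⊎ P (there z)) (derB e k C)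
  GoodWithin-der (g , p) = g-der g , λ z → ⊎-map (×-map₂ (p _)) (p _)

  GoodWithinV-pairL : ∀ {Θ σ u} {P : VarPred Γ} {C : CtxT Γ Θ σ} → GoodWithin P C → GoodWithinV P (pairL C u)
  GoodWithinV-pairL (g , p) = gv-pairL g , p

  GoodWithinV-pairR : ∀ {Θ σ t} {P : VarPred Γ} {C : CtxT Γ Θ σ} → GoodWithin P C → GoodWithinV P (pairR t C)
  GoodWithinV-pairR (g , p) = gv-pairR g , p

  GoodWithinV-lam : ∀ {Θ σ k} {P : VarPred (k ∷ Γ)} {C : CtxT (k ∷ Γ) Θ σ} →
    GoodWithin P C → GoodWithinV (λ z → P (there z)) (lam k C)
  GoodWithinV-lam (g , p) = gv-lam g , λ z → p (there z)

  GoodWithinV-bang : ∀ {Θ σ} {P : VarPred Γ} {C : CtxT Γ Θ σ} → GoodWithin P C → GoodWithinV P (bang C)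
  GoodWithinV-bang (g , p) = gv-bang g , p

-- φ sends variables of the reduct to the redex (nothing for binders created by the step). Blocked variables of the
-- redex, typically the fired cut variable, are kept from dominating by an enclosing good position, so reflection
-- is only needed for positions they do not dominate.
record Origin {Γ Δ Θ σ} (φ : PartialRen Γ Δ) (Bl : Blocked Δ) (T : Tm Δ) (B : CtxT Γ Θ σ) (v : Val (Θ ⋈ Γ)) : Set where
  constructor origin
  field
    {Θ'}    : List Kind
    {σ'}    : HSort
    B'      : CtxT Δ Θ' σ'
    v'      : Val (Θ' ⋈ Δ)
    plug-eq : T ≡ plugV B' v'
    size-eq : sizeV v ≡ sizeV v'
    reflect : Good B' → Undominated Bl B' → GoodWithin (λ z → MaybeDFV B' (φ z)) B

record OriginV {Γ Δ Θ σ} (φ : PartialRen Γ Δ) (Bl : Blocked Δ) (T : Val Δ) (B : VCtx Γ Θ σ) (v : Val (Θ ⋈ Γ)) : Set where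
  constructor originV
  field
    {Θ'}    : List Kind
    {σ'}    : HSort
    B'      : VCtx Δ Θ' σ'
    v'      : Val (Θ' ⋈ Δ)
    plug-eq : T ≡ plugVC B' (valHole σ' v')
    size-eq : sizeV v ≡ sizeV v'
    reflect : GoodV B' → UndominatedV Bl B' → GoodWithinV (λ z → MaybeDFVV B' (φ z)) B

-- E holds of the sizes of values at bad positions of the redex; P bounds the dominating variables of good positions.
Traced : ∀ {Γ Δ Θ σ} → PartialRen Γ Δ → Blocked Δ → (ℕ → Set) → VarPred Γ →
  Tm Δ → CtxT Γ Θ σ → Val (Θ ⋈ Γ) → Set
Traced φ Bl E P T B v = Origin φ Bl T B v ⊎ (E (sizeV v) ⊎ GoodWithin P B)

TracedV : ∀ {Γ Δ Θ σ} → PartialRen Γ Δ → Blocked Δ → (ℕ → Set) → VarPred Γ →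
  Val Δ → VCtx Γ Θ σ → Val (Θ ⋈ Γ) → Set
TracedV φ Bl E P T B v = OriginV φ Bl T B v ⊎ (E (sizeV v) ⊎ GoodWithinV P B)

Traces : ∀ {Γ Δ} → PartialRen Γ Δ → Blocked Δ → (ℕ → Set) → VarPred Γ → Tm Δ → Tm Γ → Set
Traces {Γ} φ Bl E P T U = ∀ {Θ σ} (B : CtxT Γ Θ σ) (v : Val (Θ ⋈ Γ)) → U ≡ plugV B v → Traced φ Bl E P T B v

AllSizes : ∀ {Γ} → (ℕ → Set) → Tm Γ → Set
AllSizes {Γ} E U = ∀ {Θ σ} (B : CtxT Γ Θ σ) (v : Val (Θ ⋈ Γ)) → U ≡ plugV B v → E (sizeV v)

AllSizesV : ∀ {Γ} → (ℕ → Set) → Val Γ → Set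
AllSizesV {Γ} E U = ∀ {Θ σ} (B : VCtx Γ Θ σ) (v : Val (Θ ⋈ Γ)) → U ≡ plugVC B (valHole σ v) → E (sizeV v)

map₃ : {A A' B B' C C' : Set} → (A → A') → (B → B') → (C → C') → A ⊎ (B ⊎ C) → A' ⊎ (B' ⊎ C')
map₃ f g h = ⊎-map f (⊎-map g h)

cutH-bad : ∀ {Γ k b} → Bad (cutH {Γ} k b)
cutH-bad ()

cutV-bad : ∀ {Γ Θ σ k} {V : VCtx Γ Θ σ} {b} → Bad (cutV k V b)
cutV-bad ()

origin-bad : ∀ {Γ Δ Θ σ Θ' σ'} {φ : PartialRen Γ Δ} {Bl : Blocked Δ} {T : Tm Δ} {B : CtxT Γ Θ σ} {v : Val (Θ ⋈ Γ)}
  (B' : CtxT Δ Θ' σ') (v' : Val (Θ' ⋈ Δ)) → Bad B' → T ≡ plugV B' v' → sizeV v ≡ sizeV v' → Origin φ Bl T B v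
origin-bad B' v' bad e s = origin B' v' e s (λ g _ → ⊥-elim (bad g))

origin-conv : ∀ {Γ Δ Θ σ} {φ₁ φ₂ : PartialRen Γ Δ} {Bl₁ Bl₂ : Blocked Δ} {T} {B : CtxT Γ Θ σ} {v} →
  (∀ {k} (z : Γ ∋ k) → φ₁ z ≡ φ₂ z) → (∀ {k} (x : Δ ∋ k) → Bl₁ x → Bl₂ x) →
  Origin φ₁ Bl₁ T B v → Origin φ₂ Bl₂ T B v
origin-conv eφ eBl (origin B' v' eq sz reflect) = origin B' v' eq sz λ g nd →
  GoodWithin-mono (λ {_} {z} → subst (MaybeDFV B') (eφ z)) (reflect g (λ x b → nd x (eBl x b)))

ren-position : ∀ {Γ Δ Θ σ} (ρ : Ren Γ Δ) (S : Tm Γ) (B : CtxT Γ Θ σ) (v : Val (Θ ⋈ Γ)) → S ≡ plugV B v →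
  Σ (Val (Θ ⋈ Δ)) λ v' → ren ρ S ≡ plugV (renC ρ B) v' × sizeV v ≡ sizeV v'
ren-position {Θ = Θ} ρ S B v refl = renV (liftΘ Θ ρ) v , ren-plugV ρ B v , sym (sizeV-ren _ v)

ren-positionV : ∀ {Γ Δ Θ σ} (ρ : Ren Γ Δ) (S : Val Γ) (B : VCtx Γ Θ σ) (v : Val (Θ ⋈ Γ)) →
  S ≡ plugVC B (valHole σ v) →
  Σ (Val (Θ ⋈ Δ)) λ v' → renV ρ S ≡ plugVC (renVC ρ B) (valHole σ v') × sizeV v ≡ sizeV v'
ren-positionV {Θ = Θ} ρ S B v refl = renV (liftΘ Θ ρ) v , renV-plugVC-valHole ρ B v , sym (sizeV-ren _ v)

module _ {Γ Δ : Scope} (ρ : Ren Γ Δ) (Bl : Blocked Δ) where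

  origin-ren : ∀ {Θ σ} (S : Tm Γ) (B : CtxT Γ Θ σ) (v : Val (Θ ⋈ Γ)) → S ≡ plugV B v →
    Origin (total ρ) Bl (ren ρ S) B v
  origin-ren S B v e with ren-position ρ S B v e
  ... | v' , e₁ , e₂ = origin (renC ρ B) v' e₁ e₂ λ g _ → good-ren⁻ ρ B g , λ z → DFV-ren ρ B z

  origin-renV : ∀ {Θ σ} (S : Val Γ) (B : VCtx Γ Θ σ) (v : Val (Θ ⋈ Γ)) → S ≡ plugVC B (valHole σ v) →
    OriginV (total ρ) Bl (renV ρ S) B v
  origin-renV S B v e with ren-positionV ρ S B v e
  ... | v' , e₁ , e₂ = originV (renVC ρ B) v' e₁ e₂ λ g _ → goodV-ren⁻ ρ B g , λ z → DFVV-ren ρ B z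

  origin-cut : ∀ {Θ σ k w w'} {T₁ : Tm (k ∷ Δ)} {B₁ : CtxT (k ∷ Γ) Θ σ} {v} →
    Origin (total (lift ρ)) (liftBlocked Bl) T₁ B₁ v → Origin (total ρ) Bl (cut k w' T₁) (cutB k w B₁) v
  origin-cut {k = k} {w' = w'} (origin B₁' v' eq sz reflect) = origin (cutB k w' B₁') v' (cong (cut k w') eq) sz
    λ { (g-cut g nd) ndom → GoodWithin-cut nd (reflect g λ { here () ; (there x) → ndom x }) }

  origin-par : ∀ {Θ σ m k1 k2} {T₁ : Tm (k2 ∷ k1 ∷ Δ)} {B₁ : CtxT (k2 ∷ k1 ∷ Γ) Θ σ} {v} →
    Origin (total (lift (lift ρ))) (liftBlocked (liftBlocked Bl)) T₁ B₁ v →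
    Origin (total ρ) Bl (par (ρ m) k1 k2 T₁) (parB m k1 k2 B₁) v
  origin-par {m = m} {k1} {k2} (origin B₁' v' eq sz reflect) =
    origin (parB (ρ m) k1 k2 B₁') v' (cong (par (ρ m) k1 k2) eq) sz
    λ { (g-par g) ndom → GoodWithin-mono (⊎-map (×-map₁ (SameVar-ren ρ _ m)) id)
          (GoodWithin-par (reflect g λ { (there (there x)) b d → ndom x b (inj₂ d) })) }

  origin-sub : ∀ {Θ σ m k w w'} {T₁ : Tm (k ∷ Δ)} {B₁ : CtxT (k ∷ Γ) Θ σ} {v} →
    Origin (total (lift ρ)) (liftBlocked Bl) T₁ B₁ v → Origin (total ρ) Bl (sub (ρ m) w' k T₁) (subB m w k B₁) v
  origin-sub {m = m} {k} {w' = w'} (origin B₁' v' eq sz reflect) =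
    origin (subB (ρ m) w' k B₁') v' (cong (sub (ρ m) w' k) eq) sz
    λ { (g-subB g) ndom → GoodWithin-mono (⊎-map (×-map₁ (SameVar-ren ρ _ m)) id)
          (GoodWithin-sub (reflect g λ { (there x) b d → ndom x b (inj₂ d) })) }

  origin-der : ∀ {Θ σ m k} {T₁ : Tm (k ∷ Δ)} {B₁ : CtxT (k ∷ Γ) Θ σ} {v} →
    Origin (total (lift ρ)) (liftBlocked Bl) T₁ B₁ v → Origin (total ρ) Bl (der (ρ m) k T₁) (derB m k B₁) v
  origin-der {m = m} {k} (origin B₁' v' eq sz reflect) = origin (derB (ρ m) k B₁') v' (cong (der (ρ m) k) eq) sz
    λ { (g-der g) ndom → GoodWithin-mono (⊎-map (×-map₁ (SameVar-ren ρ _ m)) id)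
          (GoodWithin-der (reflect g λ { (there x) b d → ndom x b (inj₂ d) })) }

  origin-val : ∀ {Θ σ} {T₁ : Val Δ} {B₁ : VCtx Γ Θ σ} {v} →
    OriginV (total ρ) Bl T₁ B₁ v → Origin (total ρ) Bl (val T₁) (val B₁) v
  origin-val (originV B₁' v' eq sz reflect) = origin (val B₁') v' (cong val eq) sz
    λ { (g-val g) ndom → GoodWithin-val (reflect g ndom) }

  origin-subV : ∀ {Θ σ m k} {b' : Tm (k ∷ Δ)} {b} {T₁ : Val Δ} {B₁ : VCtx Γ Θ σ} {v} →
    OriginV (total ρ) Bl T₁ B₁ v → Origin (total ρ) Bl (sub (ρ m) T₁ k b') (subV m B₁ k b) v
  origin-subV {m = m} {k} {b'} (originV B₁' v' eq sz reflect) =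
    origin (subV (ρ m) B₁' k b') v' (cong (λ z → sub (ρ m) z k b') eq) sz
    λ { (g-subV g) ndom → GoodWithin-mono (⊎-map (SameVar-ren ρ _ m) id)
          (GoodWithin-subV (reflect g λ x b d → ndom x b (inj₂ d))) }

  origin-pairL : ∀ {Θ σ} {u u'} {T₁ : Tm Δ} {B₁ : CtxT Γ Θ σ} {v} →
    Origin (total ρ) Bl T₁ B₁ v → OriginV (total ρ) Bl (pair T₁ u') (pairL B₁ u) v
  origin-pairL {u' = u'} (origin B₁' v' eq sz reflect) = originV (pairL B₁' u') v' (cong (λ z → pair z u') eq) sz
    λ { (gv-pairL g) ndom → GoodWithinV-pairL (reflect g ndom) }

  origin-pairR : ∀ {Θ σ} {u u'} {T₁ : Tm Δ} {B₁ : CtxT Γ Θ σ} {v} →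
    Origin (total ρ) Bl T₁ B₁ v → OriginV (total ρ) Bl (pair u' T₁) (pairR u B₁) v
  origin-pairR {u' = u'} (origin B₁' v' eq sz reflect) = originV (pairR u' B₁') v' (cong (pair u') eq) sz
    λ { (gv-pairR g) ndom → GoodWithinV-pairR (reflect g ndom) }

  origin-lam : ∀ {Θ σ k} {T₁ : Tm (k ∷ Δ)} {B₁ : CtxT (k ∷ Γ) Θ σ} {v} →
    Origin (total (lift ρ)) (liftBlocked Bl) T₁ B₁ v → OriginV (total ρ) Bl (lam k T₁) (lam k B₁) v
  origin-lam {k = k} (origin B₁' v' eq sz reflect) = originV (lam k B₁') v' (cong (lam k) eq) sz
    λ { (gv-lam g) ndom → GoodWithinV-lam (reflect g λ { (there x) → ndom x }) }

  origin-bang : ∀ {Θ σ} {T₁ : Tm Δ} {B₁ : CtxT Γ Θ σ} {v} →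
    Origin (total ρ) Bl T₁ B₁ v → OriginV (total ρ) Bl (bang T₁) (bang B₁) v
  origin-bang (origin B₁' v' eq sz reflect) = originV (bang B₁') v' (cong bang eq) sz
    λ { (gv-bang g) ndom → GoodWithinV-bang (reflect g ndom) }

-- A value hole is filled by a copy of the cut value, whose inner positions are all accounted for by E.
HoleTraces : ∀ {Γ Δ} s → Ren Γ Δ → Blocked Δ → (ℕ → Set) → (Θ : List Kind) → Hole s (Θ ⋈ Γ) → Hole s (Θ ⋈ Δ) → Set
HoleTraces tmH  ρ Bl E Θ X Y = Traces (total (liftΘ Θ ρ)) (liftBlockedΘ Θ Bl) E (λ _ → ⊥) Y X
HoleTraces valH ρ Bl E Θ X Y = AllSizesV E X

holeTraces-lift : ∀ {Γ Δ k} s {ρ : Ren Γ Δ} {Bl : Blocked Δ} {E} Θ {X Y} →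
  HoleTraces s ρ Bl E (k ∷ Θ) X Y → HoleTraces s (lift {k = k} ρ) (liftBlocked Bl) E Θ X Y
holeTraces-lift tmH  Θ h = h
holeTraces-lift valH Θ h = h

holeTraces-lift² : ∀ {Γ Δ k1 k2} s {ρ : Ren Γ Δ} {Bl : Blocked Δ} {E} Θ {X Y} → HoleTraces s ρ Bl E (k1 ∷ k2 ∷ Θ) X Y →
  HoleTraces s (lift {k = k2} (lift {k = k1} ρ)) (liftBlocked (liftBlocked Bl)) E Θ X Y
holeTraces-lift² tmH  Θ h = h
holeTraces-lift² valH Θ h = h

mutual
  traces-good-context : ∀ {Γ Δ Θ s} (ρ : Ren Γ Δ) (Bl : Blocked Δ) (E : ℕ → Set) (F : CtxT Γ Θ s) → Good F →
    (X : Hole s (Θ ⋈ Γ)) (Y : Hole s (Θ ⋈ Δ)) → HoleTraces s ρ Bl E Θ X Y →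
    Traces (total ρ) Bl E (λ z → DFV F z) (plug (renC ρ F) Y) (plug F X)
  traces-good-context ρ Bl E hole g X Y h = h
  traces-good-context ρ Bl E (val V) g X Y h hole v e = inj₂ (inj₂ GoodWithin-hole)
  traces-good-context ρ Bl E (val V) (g-val gV) X Y h (val B) v e =
    map₃ (origin-val ρ Bl) id GoodWithin-val (traces-good-vcontext ρ Bl E V gV X Y h B v (val-injective e))
  traces-good-context ρ Bl E (subH m k b) g X Y h (subH .m .k .b) .X refl = inj₂ (inj₂ GoodWithin-subH)
  traces-good-context ρ Bl E (subH m k b) g X Y h (subV m' V k' b') v e with sub-injective e
  ... | refl , refl , e₁ , refl = inj₂ (inj₁ (h V v e₁))
  traces-good-context ρ Bl E (subH m k b) g X Y h (subB m' w k' B) v e with sub-injective e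
  ... | refl , refl , refl , e₂ = inj₁ (origin-sub ρ Bl (origin-ren (lift ρ) (liftBlocked Bl) b B v e₂))
  traces-good-context ρ Bl E (subV m V k b) g X Y h (subH .m .k .b) v refl =
    inj₂ (inj₂ (GoodWithin-mono inj₁ GoodWithin-subH))
  traces-good-context ρ Bl E (subV m V k b) (g-subV gV) X Y h (subV m' V₂ k' b') v e with sub-injective e
  ... | refl , refl , e₁ , refl =
    map₃ (origin-subV ρ Bl) id GoodWithin-subV (traces-good-vcontext ρ Bl E V gV X Y h V₂ v e₁)
  traces-good-context ρ Bl E (subV m V k b) g X Y h (subB m' w k' B) v e with sub-injective e
  ... | refl , refl , refl , e₂ = inj₁ (origin-sub ρ Bl (origin-ren (lift ρ) (liftBlocked Bl) b B v e₂))
  traces-good-context ρ Bl E (cutB k w F) g X Y h (cutH .k b) .w refl =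
    inj₁ (origin-bad (cutH k _) (renV ρ w) cutH-bad refl (sym (sizeV-ren ρ w)))
  traces-good-context ρ Bl E (cutB k w F) g X Y h (cutV k' V b) v e with cut-injective e
  ... | refl , e₁ , refl with ren-positionV ρ w V v e₁
  ... | v' , e₂ , e₃ = inj₁ (origin-bad (cutV k (renVC ρ V) _) v' cutV-bad (cong (λ z → cut k z _) e₂) e₃)
  traces-good-context {s = s} ρ Bl E (cutB {Θ = Θ} k w F) (g-cut g nd) X Y h (cutB k' w' B) v e with cut-injective e
  ... | refl , refl , e₂ = map₃ (origin-cut ρ Bl) id (GoodWithin-cut nd)
    (traces-good-context (lift ρ) (liftBlocked Bl) E F g X Y (holeTraces-lift s Θ h) B v e₂)
  traces-good-context {s = s} ρ Bl E (parB {Θ = Θ} m k1 k2 F) (g-par g) X Y h (parB m' k1' k2' B) v e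
    with par-injective e
  ... | refl , refl , refl , e₂ = map₃ (origin-par ρ Bl) id GoodWithin-par
    (traces-good-context (lift (lift ρ)) (liftBlocked (liftBlocked Bl)) E F g X Y (holeTraces-lift² s Θ h) B v e₂)
  traces-good-context ρ Bl E (subB m w k F) g X Y h (subH .m .k b) .w refl =
    inj₁ (origin (subH (ρ m) k _) (renV ρ w) refl (sym (sizeV-ren ρ w))
      λ _ _ → GoodWithin-mono (SameVar-ren ρ _ m) GoodWithin-subH)
  traces-good-context ρ Bl E (subB m w k F) g X Y h (subV m' V k' b) v e with sub-injective e
  ... | refl , refl , e₁ , refl = inj₁ (origin-subV ρ Bl (origin-renV ρ Bl w V v e₁))
  traces-good-context {s = s} ρ Bl E (subB {Θ = Θ} m w k F) (g-subB g) X Y h (subB m' w' k' B) v e with sub-injective e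
  ... | refl , refl , refl , e₂ = map₃ (origin-sub ρ Bl) id GoodWithin-sub
    (traces-good-context (lift ρ) (liftBlocked Bl) E F g X Y (holeTraces-lift s Θ h) B v e₂)
  traces-good-context {s = s} ρ Bl E (derB {Θ = Θ} m k F) (g-der g) X Y h (derB m' k' B) v e with der-injective e
  ... | refl , refl , e₂ = map₃ (origin-der ρ Bl) id GoodWithin-der
    (traces-good-context (lift ρ) (liftBlocked Bl) E F g X Y (holeTraces-lift s Θ h) B v e₂)

  traces-good-vcontext : ∀ {Γ Δ Θ s Θ₁ σ} (ρ : Ren Γ Δ) (Bl : Blocked Δ) (E : ℕ → Set) (F : VCtx Γ Θ s) → GoodV F →
    (X : Hole s (Θ ⋈ Γ)) (Y : Hole s (Θ ⋈ Δ)) → HoleTraces s ρ Bl E Θ X Y →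
    (B : VCtx Γ Θ₁ σ) (v : Val (Θ₁ ⋈ Γ)) → plugVC F X ≡ plugVC B (valHole σ v) →
    TracedV (total ρ) Bl E (λ z → DFVV F z) (plugVC (renVC ρ F) Y) B v
  traces-good-vcontext ρ Bl E (pairL F u) (gv-pairL g) X Y h (pairL B u') v e with pair-injective e
  ... | e₁ , refl = map₃ (origin-pairL ρ Bl) id GoodWithinV-pairL (traces-good-context ρ Bl E F g X Y h B v e₁)
  traces-good-vcontext ρ Bl E (pairL F u) g X Y h (pairR t B) v e with pair-injective e
  ... | refl , e₂ = inj₁ (origin-pairR ρ Bl (origin-ren ρ Bl u B v e₂))
  traces-good-vcontext ρ Bl E (pairR t F) (gv-pairR g) X Y h (pairR t' B) v e with pair-injective e
  ... | refl , e₂ = map₃ (origin-pairR ρ Bl) id GoodWithinV-pairR (traces-good-context ρ Bl E F g X Y h B v e₂)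
  traces-good-vcontext ρ Bl E (pairR t F) g X Y h (pairL B u) v e with pair-injective e
  ... | e₁ , refl = inj₁ (origin-pairL ρ Bl (origin-ren ρ Bl t B v e₁))
  traces-good-vcontext {s = s} ρ Bl E (lam {Θ = Θ} k F) (gv-lam g) X Y h (lam k' B) v e with lam-injective e
  ... | refl , e₁ = map₃ (origin-lam ρ Bl) id GoodWithinV-lam
    (traces-good-context (lift ρ) (liftBlocked Bl) E F g X Y (holeTraces-lift s Θ h) B v e₁)
  traces-good-vcontext ρ Bl E (bang F) (gv-bang g) X Y h (bang B) v e =
    map₃ (origin-bang ρ Bl) id GoodWithinV-bang (traces-good-context ρ Bl E F g X Y h B v (bang-injective e))

record BadPosition {Γ} (t : Tm Γ) (n : ℕ) : Set where
  constructor badPosition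
  field
    {Θ'} : List Kind
    {σ'} : HSort
    B'   : CtxT Γ Θ' σ'
    v'   : Val (Θ' ⋈ Γ)
    bad  : Bad B'
    eq   : t ≡ plugV B' v'
    sz   : n ≡ sizeV v'

record BadPositionV {Γ} (t : Val Γ) (n : ℕ) : Set where
  constructor badPositionV
  field
    {Θ'} : List Kind
    {σ'} : HSort
    B'   : VCtx Γ Θ' σ'
    v'   : Val (Θ' ⋈ Γ)
    bad  : ¬ GoodV B'
    eq   : t ≡ plugVC B' (valHole σ' v')
    sz   : n ≡ sizeV v'

-- Positions strictly inside the cut value are bad, as cut(V, x.t) is never good.
badPosition-cut-value : ∀ {Γ Γ' k Θ σ} (w : Val Γ) (body : Tm (k ∷ Γ)) (ρ : Ren Γ Γ') (V : VCtx Γ' Θ σ) (v : Val (Θ ⋈ Γ')) →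
  renV ρ w ≡ plugVC V (valHole σ v) → BadPosition (cut k w body) (sizeV v)
badPosition-cut-value w body ρ V v e with renV-plugVC⁻ ρ w V v e
... | V₀ , v₀ , refl , refl , refl = badPosition (cutV _ V₀ body) v₀ cutV-bad refl (sizeV-ren _ v₀)

badPosition-ren : ∀ {Γ Γ' Γt} (S : Tm Γ) (t : Tm Γt) →
  (∀ {Θ σ} (B : CtxT Γ Θ σ) (v : Val (Θ ⋈ Γ)) → S ≡ plugV B v → BadPosition t (sizeV v)) →
  (ρ : Ren Γ Γ') → AllSizes (BadPosition t) (ren ρ S)
badPosition-ren S t h ρ B v e with ren-plugV⁻ ρ S B v e
... | B₀ , v₀ , e₀ , refl , refl = subst (BadPosition t) (sym (sizeV-ren _ v₀)) (h B₀ v₀ e₀)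

holeTraces-copy : ∀ {Γ Γ' Δ k} s (ρ : Ren Γ' Δ) (Bl : Blocked Δ) Θ (w : Val Γ) (body : Tm (k ∷ Γ))
  (ρ' : Ren Γ (Θ ⋈ Γ')) (Y : Hole s (Θ ⋈ Δ)) →
  HoleTraces s ρ Bl (BadPosition (cut k w body)) Θ (valHole s (renV ρ' w)) Y
holeTraces-copy tmH  ρ Bl Θ w body ρ' Y hole    v e = inj₂ (inj₂ GoodWithin-hole)
holeTraces-copy tmH  ρ Bl Θ w body ρ' Y (val V) v e = inj₂ (inj₁ (badPosition-cut-value w body ρ' V v (val-injective e)))
holeTraces-copy valH ρ Bl Θ w body ρ' Y V       v e = badPosition-cut-value w body ρ' V v e

origin-cut-target : ∀ {Γ Δ Θ σ k} {φ : PartialRen (k ∷ Γ) Δ} {Bl : Blocked Δ} {T : Tm Δ} {w : Val Γ}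
  {B₁ : CtxT (k ∷ Γ) Θ σ} {v} → (∀ {Θ' σ'} (B' : CtxT Δ Θ' σ') → Undominated Bl B' → ¬ MaybeDFV B' (φ here)) →
  Origin φ Bl T B₁ v → Origin (λ z → φ (there z)) Bl T (cutB k w B₁) v
origin-cut-target never (origin B' v' eq sz reflect) = origin B' v' eq sz λ g nd →
  GoodWithin-cut (never B' nd) (reflect g nd)

unguard : {A B : Set} → (A × ⊥) ⊎ B → B
unguard (inj₂ b) = b

unguard² : {A B : Set} → (A × (⊥ ⊎ ⊥)) ⊎ B → B
unguard² (inj₁ (_ , inj₁ ()))
unguard² (inj₁ (_ , inj₂ ()))
unguard² (inj₂ b) = b

origin-par-target : ∀ {Γ Δ Θ σ m k1 k2} {φ : PartialRen Γ Δ} {Bl : Blocked Δ} {T : Tm Δ}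
  {B₁ : CtxT (k2 ∷ k1 ∷ Γ) Θ σ} {v} → Origin (extNothing (extNothing φ)) Bl T B₁ v → Origin φ Bl T (parB m k1 k2 B₁) v
origin-par-target (origin B' v' eq sz reflect) = origin B' v' eq sz λ g nd →
  GoodWithin-mono unguard² (GoodWithin-par (reflect g nd))

origin-sub-target : ∀ {Γ Δ Θ σ m w k} {φ : PartialRen Γ Δ} {Bl : Blocked Δ} {T : Tm Δ}
  {B₁ : CtxT (k ∷ Γ) Θ σ} {v} → Origin (extNothing φ) Bl T B₁ v → Origin φ Bl T (subB m w k B₁) v
origin-sub-target (origin B' v' eq sz reflect) = origin B' v' eq sz λ g nd →
  GoodWithin-mono unguard (GoodWithin-sub (reflect g nd))

origin-der-target : ∀ {Γ Δ Θ σ e k} {φ : PartialRen Γ Δ} {Bl : Blocked Δ} {T : Tm Δ}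
  {B₁ : CtxT (k ∷ Γ) Θ σ} {v} → Origin (extNothing φ) Bl T B₁ v → Origin φ Bl T (derB e k B₁) v
origin-der-target (origin B' v' eq sz reflect) = origin B' v' eq sz λ g nd →
  GoodWithin-mono unguard (GoodWithin-der (reflect g nd))

allSizes-cut : ∀ {Γ k E} {w : Val Γ} {S : Tm (k ∷ Γ)} → AllSizes E (cut k w S) → AllSizes E (val w)
allSizes-cut {k = k} {S = S} h hole    v e = h (cutH k S) v (cong (λ z → cut k z S) (val-injective e))
allSizes-cut {k = k} {S = S} h (val V) v e = h (cutV k V S) v (cong (λ z → cut k z S) (val-injective e))

traces-cut-target : ∀ {Γ Δ k} {φ : PartialRen (k ∷ Γ) Δ} {Bl : Blocked Δ} {E : ℕ → Set} {T : Tm Δ}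
  (w : Val Γ) (R : Tm (k ∷ Γ)) → (∀ {Θ' σ'} (B' : CtxT Δ Θ' σ') → Undominated Bl B' → ¬ MaybeDFV B' (φ here)) →
  AllSizes E (val w) → Traces φ Bl E (λ _ → ⊥) T R → Traces (λ z → φ (there z)) Bl E (λ _ → ⊥) T (cut k w R)
traces-cut-target w R never hw tr (cutH _ _) v refl = inj₂ (inj₁ (hw hole w refl))
traces-cut-target w R never hw tr (cutV _ V _) v e with cut-injective e
... | refl , e₁ , refl = inj₂ (inj₁ (hw (val V) v (cong val e₁)))
traces-cut-target w R never hw tr (cutB _ _ B) v e with cut-injective e
... | refl , refl , e₂ = map₃ (origin-cut-target never) id (GoodWithin-cut id) (tr B v e₂)

-- The binders of a left context L exist only in the reduct; the sizes inside L are accounted for separately.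
traces-left : ∀ {Γ Δ ΘL} {Bl : Blocked Δ} {E : ℕ → Set} (L : CtxT Γ ΘL tmH) → IsL L → (φ : PartialRen Γ Δ) (T : Tm Δ)
  (Z : Tm (ΘL ⋈ Γ)) (vL : Val (ΘL ⋈ Γ)) → AllSizes E (plug L (val vL)) →
  (AllSizes E (val vL) → Traces (extNothingΘ ΘL φ) Bl E (λ _ → ⊥) T Z) → Traces φ Bl E (λ _ → ⊥) T (plug L Z)
traces-left hole l-hole φ T Z vL hL tZ = tZ hL
traces-left {E = E} (cutB k w L) (l-cut l) φ T Z vL hL tZ =
  traces-cut-target {E = E} w (plug L Z) (λ B' nd ()) (allSizes-cut {E = E} hL)
    (traces-left {E = E} L l (extNothing φ) T Z vL (λ B v e → hL (cutB k w B) v (cong (cut k w) e)) tZ)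
traces-left {E = E} (parB m k1 k2 L) (l-par l) φ T Z vL hL tZ (parB _ _ _ B) v e with par-injective e
... | refl , refl , refl , e₂ = map₃ origin-par-target id (λ p → GoodWithin-mono unguard² (GoodWithin-par p))
  (traces-left {E = E} L l (extNothing (extNothing φ)) T Z vL (λ B v e → hL (parB m k1 k2 B) v (cong (par m k1 k2) e)) tZ B v e₂)
traces-left (subB m w k L) (l-sub l) φ T Z vL hL tZ (subH _ _ _) v refl = inj₂ (inj₁ (hL (subH m k _) w refl))
traces-left (subB m w k L) (l-sub l) φ T Z vL hL tZ (subV _ V _ _) v e with sub-injective e
... | refl , refl , e₁ , refl = inj₂ (inj₁ (hL (subV m V k _) v (cong (λ z → sub m z k _) e₁)))
traces-left {E = E} (subB m w k L) (l-sub l) φ T Z vL hL tZ (subB _ _ _ B) v e with sub-injective e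
... | refl , refl , refl , e₂ = map₃ origin-sub-target id (λ p → GoodWithin-mono unguard (GoodWithin-sub p))
  (traces-left {E = E} L l (extNothing φ) T Z vL (λ B v e → hL (subB m w k B) v (cong (sub m w k) e)) tZ B v e₂)
traces-left {E = E} (derB m k L) (l-der l) φ T Z vL hL tZ (derB _ _ B) v e with der-injective e
... | refl , refl , e₂ = map₃ origin-der-target id (λ p → GoodWithin-mono unguard (GoodWithin-der p))
  (traces-left {E = E} L l (extNothing φ) T Z vL (λ B v e → hL (derB m k B) v (cong (der m k) e)) tZ B v e₂)

maybeDFV-der : ∀ {Δ k k' Θ σ} {e : Δ ∋ exp} {B' : CtxT (k' ∷ Δ) Θ σ} (y : Maybe (Δ ∋ k)) →
  MaybeDFV B' (maybe-map there y) → MaybeDFV (derB e k' B') y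
maybeDFV-der (just y) d = inj₂ d

maybeDFV-sub : ∀ {Δ k k' Θ σ} {m : Δ ∋ mul} {w} {B' : CtxT (k' ∷ Δ) Θ σ} (y : Maybe (Δ ∋ k)) →
  MaybeDFV B' (maybe-map there y) → MaybeDFV (subB m w k' B') y
maybeDFV-sub (just y) d = inj₂ d

maybeDFV-par : ∀ {Δ k k1 k2 Θ σ} {m : Δ ∋ mul} {B' : CtxT (k2 ∷ k1 ∷ Δ) Θ σ} (y : Maybe (Δ ∋ k)) →
  MaybeDFV B' (maybe-map (λ x → there (there x)) y) → MaybeDFV (parB m k1 k2 B') y
maybeDFV-par (just y) d = inj₂ d

module _ {Γ Δ : Scope} {φ : PartialRen Γ Δ} {Bl : Blocked Δ} {E : ℕ → Set} {P : VarPred Γ} {U : Tm Γ} where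

  traces-der-source : ∀ {k} (e : Δ ∋ exp) {T₁ : Tm (k ∷ Δ)} →
    Traces (λ z → maybe-map there (φ z)) (blockedLike e Bl) E P T₁ U → Traces φ Bl E P (der e k T₁) U
  traces-der-source {k} e tr B v eq = ⊎-map lift-origin id (tr B v eq)
    where
    lift-origin : Origin (λ z → maybe-map there (φ z)) (blockedLike e Bl) _ B v → Origin φ Bl (der e k _) B v
    lift-origin (origin B₁' v' eq sz reflect) = origin (derB e k B₁') v' (cong (der e k) eq) sz
      λ { (g-der g) nd → GoodWithin-mono (λ {_} {z} → maybeDFV-der {e = e} {B' = B₁'} (φ z))
            (reflect g λ { here b d → nd e b (inj₁ (refl , d)) ; (there x) b d → nd x b (inj₂ d) }) }

  traces-sub-source : ∀ {k} (m : Δ ∋ mul) (w : Val Δ) {T₁ : Tm (k ∷ Δ)} →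
    Traces (λ z → maybe-map there (φ z)) (blockedLike m Bl) E P T₁ U → Traces φ Bl E P (sub m w k T₁) U
  traces-sub-source {k} m w tr B v eq = ⊎-map lift-origin id (tr B v eq)
    where
    lift-origin : Origin (λ z → maybe-map there (φ z)) (blockedLike m Bl) _ B v → Origin φ Bl (sub m w k _) B v
    lift-origin (origin B₁' v' eq sz reflect) = origin (subB m w k B₁') v' (cong (sub m w k) eq) sz
      λ { (g-subB g) nd → GoodWithin-mono (λ {_} {z} → maybeDFV-sub {m = m} {w = w} {B' = B₁'} (φ z))
            (reflect g λ { here b d → nd m b (inj₁ (refl , d)) ; (there x) b d → nd x b (inj₂ d) }) }

  traces-par-source : ∀ {k1 k2} (m : Δ ∋ mul) {T₁ : Tm (k2 ∷ k1 ∷ Δ)} →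
    Traces (λ z → maybe-map (λ y → there (there y)) (φ z)) (blockedLike² m Bl) E P T₁ U →
    Traces φ Bl E P (par m k1 k2 T₁) U
  traces-par-source {k1} {k2} m tr B v eq = ⊎-map lift-origin id (tr B v eq)
    where
    lift-origin : Origin (λ z → maybe-map (λ y → there (there y)) (φ z)) (blockedLike² m Bl) _ B v →
      Origin φ Bl (par m k1 k2 _) B v
    lift-origin (origin B₁' v' eq sz reflect) = origin (parB m k1 k2 B₁') v' (cong (par m k1 k2) eq) sz
      λ { (g-par g) nd → GoodWithin-mono (λ {_} {z} → maybeDFV-par {m = m} {B' = B₁'} (φ z))
            (reflect g λ { here b d → nd m b (inj₁ (refl , inj₂ d))
                         ; (there here) b d → nd m b (inj₁ (refl , inj₁ d))
                         ; (there (there x)) b d → nd x b (inj₂ d) }) }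

traces-ren : ∀ {Γ₀ Γ Δ} {φ : PartialRen Γ Δ} {Bl : Blocked Δ} {E : ℕ → Set} {P : VarPred Γ}
  (σᵤ : Ren Γ₀ Γ) (σₜ : Ren Γ₀ Δ) (S : Tm Γ₀) {T : Tm Δ} → T ≡ ren σₜ S →
  (∀ {k} (x : Γ₀ ∋ k) → φ (σᵤ x) ≡ just (σₜ x)) → Traces φ Bl E P T (ren σᵤ S)
traces-ren {φ = φ} σᵤ σₜ S refl agree {Θ} B v e with ren-plugV⁻ σᵤ S B v e
... | B₀ , v₀ , refl , refl , refl =
  inj₁ (origin (renC σₜ B₀) (renV (liftΘ Θ σₜ) v₀) (ren-plugV σₜ B₀ v₀) (trans (sizeV-ren _ v₀) (sym (sizeV-ren _ v₀)))
    λ g _ → good-ren σᵤ B₀ (good-ren⁻ σₜ B₀ g) , λ z d → dominating (DFV-ren⁻ σᵤ B₀ z d))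
  where
  dominating : ∀ {k} {z : _ ∋ k} → DFVPreimage σᵤ B₀ z → MaybeDFV (renC σₜ B₀) (φ z)
  dominating {z = z} (_ , x , d , same) with idx-injective (σᵤ x) z same
  ... | refl , refl = subst (MaybeDFV (renC σₜ B₀)) (sym (agree x)) (DFV-ren σₜ B₀ x d)

-- The fired cut variable is blocked in the body: goodness of cut(w, m.B') asks that m not dominate B'.
traces-fired-cut : ∀ {Γ} {w : Val Γ} {body : Tm (mul ∷ Γ)} {U : Tm Γ} {E : ℕ → Set} {P₁ P : VarPred Γ} →
  (∀ {k} {z : Γ ∋ k} → P₁ z → P z) → Traces (total there) hereBlocked E P₁ body U →
  Traces (total idRen) noneBlocked E P (cut mul w body) U
traces-fired-cut {w = w} weaken tr B v eq = map₃ lift-origin id (GoodWithin-mono weaken) (tr B v eq)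
  where
  lift-origin : Origin (total there) hereBlocked _ B v → Origin (total idRen) noneBlocked _ B v
  lift-origin (origin B₁' v' eq sz reflect) = origin (cutB mul w B₁') v' (cong (cut mul w) eq) sz
    λ { (g-cut g nd) _ → reflect g λ { here tt → nd } }

traces-cut-exp : ∀ {Γ Θ s} {ve : Val Γ} {C : CtxT (exp ∷ Γ) Θ s} {T₁ U₁ : Tm (exp ∷ Γ)} {E : ℕ → Set} →
  ¬ DFV C here → Traces (total idRen) hereBlocked E (λ z → DFV C z) T₁ U₁ →
  Traces (total idRen) noneBlocked E (λ z → DFV (cutB exp ve C) z) (cut exp ve T₁) (cut exp ve U₁)
traces-cut-exp {ve = ve} {T₁ = T₁} ndC tr (cutH _ _) v refl = inj₁ (origin-bad (cutH exp T₁) ve cutH-bad refl refl)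
traces-cut-exp {ve = ve} {T₁ = T₁} ndC tr (cutV _ V _) v e with cut-injective e
... | refl , e₁ , refl = inj₁ (origin-bad (cutV exp V T₁) v cutV-bad (cong (λ z → cut exp z T₁) e₁) refl)
traces-cut-exp {ve = ve} ndC tr (cutB _ _ B) v e with cut-injective e
... | refl , refl , e₂ = map₃ lift-origin id (GoodWithin-cut ndC) (tr B v e₂)
  where
  lift-origin : Origin (total idRen) hereBlocked _ B v → Origin (total idRen) noneBlocked _ (cutB exp ve B) v
  lift-origin (origin B₁' v' eq sz reflect) = origin (cutB exp ve B₁') v' (cong (cut exp ve) eq) sz
    λ { (g-cut g nd) _ → GoodWithin-cut nd (reflect g λ { here tt → nd }) }

-- The root rules

StepTraces : ∀ {Γ} → Tm Γ → VarPred Γ → Tm Γ → Set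
StepTraces t P u = Traces (total idRen) noneBlocked (BadPosition t) P t u

StepTracesV : ∀ {Γ} → Val Γ → VarPred Γ → Val Γ → Set
StepTracesV {Γ} t P u = ∀ {Θ σ} (B : VCtx Γ Θ σ) (v : Val (Θ ⋈ Γ)) → u ≡ plugVC B (valHole σ v) →
  TracedV (total idRen) noneBlocked (BadPositionV t) P t B v

traces-good-context-id : ∀ {Γ Θ s} (Bl : Blocked Γ) (E : ℕ → Set) (F : CtxT Γ Θ s) → Good F →
  (X Y : Hole s (Θ ⋈ Γ)) → HoleTraces s idRen Bl E Θ X Y →
  Traces (total idRen) Bl E (λ z → DFV F z) (plug F Y) (plug F X)
traces-good-context-id Bl E F g X Y h =
  subst (λ F' → Traces (total idRen) Bl E (λ z → DFV F z) (plug F' Y) (plug F X)) (renC-id idRen (λ _ → refl) F)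
    (traces-good-context idRen Bl E F g X Y h)

traces-ax-m1 : ∀ {Γ Θ s} (vm : Val Γ) (M : CtxT Γ Θ s) → Good (cutB mul vm (renC there M)) →
  StepTraces (cut mul vm (plugV (renC there M) (var (wkΘ Θ here))))
             (λ z → DFV (cutB mul vm (renC there M)) z)
             (plugV M (renV (wkΘ Θ) vm))
traces-ax-m1 {Θ = Θ} {s} vm M (g-cut gM _) =
  traces-fired-cut {E = E} (λ {_} {z} → DFV-ren there M z)
    (traces-good-context there hereBlocked E M (good-ren⁻ there M gM)
      (valHole s (renV (wkΘ Θ) vm)) (valHole s (var (wkΘ Θ here)))
      (holeTraces-copy s there hereBlocked Θ vm _ (wkΘ Θ) _))
  where E = BadPosition (cut mul vm (plugV (renC there M) (var (wkΘ Θ here))))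

-- A dominating variable of the renamed position cannot be the cut variable, since the source position is good.
traces-ax-m2 : ∀ {Γ Θ s} (n : Γ ∋ mul) (t : Tm (mul ∷ Γ)) (D : CtxT (mul ∷ Γ) Θ s) → Good (cutB mul (var n) D) →
  StepTraces (cut mul (var n) t) (λ z → DFV (cutB mul (var n) D) z) (ren [ n /0] t)
traces-ax-m2 n t D _ B v e with ren-plugV⁻ [ n /0] t B v e
... | B₀ , v₀ , e₀ , refl , refl = inj₁ (origin (cutB mul (var n) B₀) v₀ (cong (cut mul (var n)) e₀) (sizeV-ren _ v₀)
  λ { (g-cut g nd) _ → good-ren [ n /0] B₀ g , λ z d → dominating nd (DFV-ren⁻ [ n /0] B₀ z d) })
  where
  dominating : ¬ DFV B₀ here → ∀ {k} {z : _ ∋ k} → DFVPreimage [ n /0] B₀ z → DFV B₀ (there z)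
  dominating nd (_ , here , d , _) = ⊥-elim (nd d)
  dominating nd {z = z} (_ , there x , d , same) with idx-injective x z same
  ... | refl , refl = d

traces-weak : ∀ {Γ} (ve : Val Γ) (t : Tm Γ) → StepTraces (cut exp ve (ren there t)) (λ z → DFV {Γ} hole z) t
traces-weak ve t B v e with ren-position there t B v e
... | v' , e₁ , e₂ = inj₁ (origin (cutB exp ve (renC there B)) v' (cong (cut exp ve) e₁) e₂
  λ { (g-cut g _) _ → good-ren⁻ there B g , λ z → DFV-ren there B z })

traces-ax-e1 : ∀ {Γ Θ s} (ve : Val Γ) (C : CtxT (exp ∷ Γ) Θ s) → Good (cutB exp ve C) →
  StepTraces (cut exp ve (plugV C (var (wkΘ Θ here))))
             (λ z → DFV (cutB exp ve C) z)
             (cut exp ve (plugV C (renV (wkΘ Θ ∘ʳ there) ve)))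
traces-ax-e1 {Θ = Θ} {s} ve C (g-cut gC ndC) =
  traces-cut-exp {C = C} {E = E} ndC (traces-good-context-id hereBlocked E C gC
    (valHole s (renV (wkΘ Θ ∘ʳ there) ve)) (valHole s (var (wkΘ Θ here)))
    (holeTraces-copy s idRen hereBlocked Θ ve _ (wkΘ Θ ∘ʳ there) _))
  where E = BadPosition (cut exp ve (plugV C (var (wkΘ Θ here))))

holeTraces-ax-e2 : ∀ {Γ Θ k} {E : ℕ → Set} (f : Γ ∋ exp) (t : Tm (k ∷ (Θ ⋈ (exp ∷ Γ)))) →
  Traces (total (liftΘ Θ idRen)) (liftBlockedΘ Θ hereBlocked) E (λ _ → ⊥) (der (wkΘ Θ here) k t) (der (wkΘ Θ (there f)) k t)
holeTraces-ax-e2 {Θ = Θ} {k} f t (derB _ _ B) v e with der-injective e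
... | refl , refl , e₂ = inj₁ (origin (derB (wkΘ Θ here) k B) v (cong (der (wkΘ Θ here) k) e₂) refl
  λ { (g-der g) nd → g-der g ,
       λ { z (inj₁ (_ , d)) → ⊥-elim (nd (wkΘ Θ here) (liftBlockedΘ-wk Θ hereBlocked here tt) (inj₁ (refl , d)))
         ; z (inj₂ d) → inj₂ (subst (λ y → DFV B (there y)) (sym (liftΘ-id Θ idRen (λ _ → refl) z)) d) } })

traces-ax-e2 : ∀ {Γ Θ k} (f : Γ ∋ exp) (C : CtxT (exp ∷ Γ) Θ tmH) (t : Tm (k ∷ (Θ ⋈ (exp ∷ Γ)))) →
  Good (cutB exp (var f) C) →
  StepTraces (cut exp (var f) (plugT C (der (wkΘ Θ here) k t)))
             (λ z → DFV (cutB exp (var f) C) z)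
             (cut exp (var f) (plugT C (der (wkΘ Θ (there f)) k t)))
traces-ax-e2 {Θ = Θ} {k} f C t (g-cut gC ndC) =
  traces-cut-exp {C = C} {E = E} ndC (traces-good-context-id hereBlocked E C gC
    (der (wkΘ Θ (there f)) k t) (der (wkΘ Θ here) k t) (holeTraces-ax-e2 {Θ = Θ} {E = E} f t))
  where E = BadPosition (cut exp (var f) (plugT C (der (wkΘ Θ here) k t)))

traces-bang-der : ∀ {Γ Θ ΘL k} (s : Tm Γ) (C : CtxT (exp ∷ Γ) Θ tmH) (t : Tm (k ∷ (Θ ⋈ (exp ∷ Γ)))) →
  (L : CtxT (Θ ⋈ (exp ∷ Γ)) ΘL tmH) → IsL L → (v : Val (ΘL ⋈ (Θ ⋈ (exp ∷ Γ)))) →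
  ren (wkΘ Θ ∘ʳ there) s ≡ plugV L v → Good (cutB exp (bang s) C) →
  StepTraces (cut exp (bang s) (plugT C (der (wkΘ Θ here) k t)))
             (λ z → DFV (cutB exp (bang s) C) z)
             (cut exp (bang s) (plugT C (plugT L (cut k v (ren (lift (wkΘ ΘL)) t)))))
traces-bang-der {Γ} {Θ} {ΘL} {k} s C t L isL v eqL (g-cut gC ndC) =
  traces-cut-exp {C = C} {E = E} ndC (traces-good-context-id hereBlocked E C gC X Y hole-traces)
  where
  Y = der (wkΘ Θ here) k t
  body = plugT C Y
  E = BadPosition (cut exp (bang s) body)
  R = ren (lift (wkΘ ΘL)) t
  X = plugT L (cut k v R)
  φ₁ : PartialRen (Θ ⋈ (exp ∷ Γ)) (k ∷ (Θ ⋈ (exp ∷ Γ)))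
  φ₁ z = maybe-map there (total (liftΘ Θ idRen) z)
  Bl₁ : Blocked (k ∷ (Θ ⋈ (exp ∷ Γ)))
  Bl₁ = blockedLike (wkΘ Θ here) (liftBlockedΘ Θ hereBlocked)
  inside-s : ∀ {Θ' σ} (B : CtxT Γ Θ' σ) (w : Val (Θ' ⋈ Γ)) → s ≡ plugV B w → E (sizeV w)
  inside-s B w e = badPosition (cutV exp (bang B) body) w cutV-bad (cong (λ z → cut exp (bang z) body) e) refl
  inside-L : AllSizes E (plug L (val v))
  inside-L B w e = badPosition-ren s _ inside-s (wkΘ Θ ∘ʳ there) B w (trans eqL e)
  φ₂ : PartialRen (k ∷ (ΘL ⋈ (Θ ⋈ (exp ∷ Γ)))) (k ∷ (Θ ⋈ (exp ∷ Γ)))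
  φ₂ = consPartial here (extNothingΘ ΘL φ₁)
  agree : ∀ {k'} (x : (k ∷ (Θ ⋈ (exp ∷ Γ))) ∋ k') → φ₂ (lift (wkΘ ΘL) x) ≡ just (idRen x)
  agree here      = refl
  agree (there y) = trans (extNothingΘ-wk ΘL φ₁ y) (cong (λ q → just (there q)) (liftΘ-id Θ idRen (λ _ → refl) y))
  traces-body : AllSizes E (val v) → Traces (extNothingΘ ΘL φ₁) Bl₁ E (λ _ → ⊥) t (cut k v R)
  traces-body hv = traces-cut-target {φ = φ₂} {E = E} v R (λ B' nd d → nd here (liftBlockedΘ-wk Θ hereBlocked here tt) d) hv
    (traces-ren {E = E} (lift (wkΘ ΘL)) idRen t (sym (ren-id idRen (λ _ → refl) t)) agree)
  hole-traces : Traces (total (liftΘ Θ idRen)) (liftBlockedΘ Θ hereBlocked) E (λ _ → ⊥) Y X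
  hole-traces = traces-der-source {E = E} (wkΘ Θ here) (traces-left {Bl = Bl₁} {E = E} L isL φ₁ t (cut k v R) v inside-L traces-body)

traces-lolli : ∀ {Γ Θ ΘL ky kx} (s : Tm (ky ∷ Γ)) (M : CtxT Γ Θ tmH) →
  (v : Val (Θ ⋈ Γ)) (t : Tm (kx ∷ (Θ ⋈ Γ))) →
  (L : CtxT (ky ∷ (Θ ⋈ Γ)) ΘL tmH) → IsL L → (v' : Val (ΘL ⋈ (ky ∷ (Θ ⋈ Γ)))) →
  ren (lift (wkΘ Θ)) s ≡ plugV L v' → Good (cutB mul (lam ky s) (renC there M)) →
  StepTraces (cut mul (lam ky s)
               (plugT (renC there M) (sub (wkΘ Θ here) (renV (liftΘ Θ there) v) kx (ren (lift (liftΘ Θ there)) t))))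
             (λ z → DFV (cutB mul (lam ky s) (renC there M)) z)
             (plugT M (cut ky v (plugT L (cut kx v' (ren (lift (wkΘ ΘL ∘ʳ there)) t)))))
traces-lolli {Γ} {Θ} {ΘL} {ky} {kx} s M v t L isL v' eqL (g-cut gM _) =
  traces-fired-cut {E = E} (λ {_} {z} → DFV-ren there M z) (traces-good-context there hereBlocked E M (good-ren⁻ there M gM) X Y hole-traces)
  where
  ρΘ : Ren (Θ ⋈ Γ) (Θ ⋈ (mul ∷ Γ))
  ρΘ = liftΘ Θ there
  mΘ : (Θ ⋈ (mul ∷ Γ)) ∋ mul
  mΘ = wkΘ Θ here
  T₀ = ren (lift ρΘ) t
  Y = sub mΘ (renV ρΘ v) kx T₀
  body = plugT (renC there M) Y
  E = BadPosition (cut mul (lam ky s) body)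
  R = ren (lift (wkΘ ΘL ∘ʳ there)) t
  X₁ = plugT L (cut kx v' R)
  X = cut ky v X₁
  Bl₀ : Blocked (Θ ⋈ (mul ∷ Γ))
  Bl₀ = liftBlockedΘ Θ hereBlocked
  cutVarBlocked : Bl₀ mΘ
  cutVarBlocked = liftBlockedΘ-wk Θ hereBlocked here tt
  φ₀ : PartialRen (ky ∷ (Θ ⋈ Γ)) (Θ ⋈ (mul ∷ Γ))
  φ₀ = extNothing (total ρΘ)
  φ₁ : PartialRen (ky ∷ (Θ ⋈ Γ)) (kx ∷ (Θ ⋈ (mul ∷ Γ)))
  φ₁ z = maybe-map there (φ₀ z)
  Bl₁ : Blocked (kx ∷ (Θ ⋈ (mul ∷ Γ)))
  Bl₁ = blockedLike mΘ Bl₀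
  inside-s : ∀ {Θ' σ} (B : CtxT (ky ∷ Γ) Θ' σ) (w : Val (Θ' ⋈ (ky ∷ Γ))) → s ≡ plugV B w → E (sizeV w)
  inside-s B w e = badPosition (cutV mul (lam ky B) body) w cutV-bad (cong (λ z → cut mul (lam ky z) body) e) refl
  inside-L : AllSizes E (plug L (val v'))
  inside-L B w e = badPosition-ren s _ inside-s (lift (wkΘ Θ)) B w (trans eqL e)
  φ₂ : PartialRen (kx ∷ (ΘL ⋈ (ky ∷ (Θ ⋈ Γ)))) (kx ∷ (Θ ⋈ (mul ∷ Γ)))
  φ₂ = consPartial here (extNothingΘ ΘL φ₁)
  agree : ∀ {k'} (x : (kx ∷ (Θ ⋈ Γ)) ∋ k') → φ₂ (lift (wkΘ ΘL ∘ʳ there) x) ≡ just (lift ρΘ x)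
  agree here      = refl
  agree (there y) = extNothingΘ-wk ΘL φ₁ (there y)
  traces-body : AllSizes E (val v') → Traces (extNothingΘ ΘL φ₁) Bl₁ E (λ _ → ⊥) T₀ (cut kx v' R)
  traces-body hv = traces-cut-target {φ = φ₂} {E = E} v' R (λ B' nd d → nd here cutVarBlocked d) hv
    (traces-ren {E = E} (lift (wkΘ ΘL ∘ʳ there)) (lift ρΘ) t refl agree)
  traces-X₁ : Traces φ₀ Bl₀ E (λ _ → ⊥) Y X₁
  traces-X₁ = traces-sub-source {E = E} mΘ (renV ρΘ v) (traces-left {Bl = Bl₁} {E = E} L isL φ₁ T₀ (cut kx v' R) v' inside-L traces-body)
  -- The argument v of the sub is now the cut value; its positions sit below sub(m, ...), which m dominates.
  hole-traces : Traces (total (liftΘ Θ there)) (liftBlockedΘ Θ hereBlocked) E (λ _ → ⊥) Y X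
  hole-traces (cutH _ _) .v refl =
    inj₁ (origin (subH mΘ kx T₀) (renV ρΘ v) refl (sym (sizeV-ren ρΘ v)) λ _ nd → ⊥-elim (nd mΘ cutVarBlocked refl))
  hole-traces (cutV _ V _) w e with cut-injective e
  ... | refl , e₁ , refl with ren-positionV ρΘ v V w e₁
  ... | w' , e₂ , e₃ = inj₁ (origin (subV mΘ (renVC ρΘ V) kx T₀) w' (cong (λ z → sub mΘ z kx T₀) e₂) e₃
         λ _ nd → ⊥-elim (nd mΘ cutVarBlocked (inj₁ refl)))
  hole-traces (cutB _ _ B) w e with cut-injective e
  ... | refl , refl , e₂ = map₃ (origin-cut-target (λ _ _ ())) id (GoodWithin-cut id) (traces-X₁ B w e₂)

traces-tensor : ∀ {Γ Θ ΘL ΘL' k1 k2} (s u : Tm Γ) (M : CtxT Γ Θ tmH) (t : Tm (k2 ∷ k1 ∷ (Θ ⋈ Γ))) →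
  (L : CtxT (Θ ⋈ Γ) ΘL tmH) → IsL L → (v : Val (ΘL ⋈ (Θ ⋈ Γ))) → ren (wkΘ Θ) s ≡ plugV L v →
  (L' : CtxT (k1 ∷ (ΘL ⋈ (Θ ⋈ Γ))) ΘL' tmH) → IsL L' → (v' : Val (ΘL' ⋈ (k1 ∷ (ΘL ⋈ (Θ ⋈ Γ))))) →
  ren (there ∘ʳ (wkΘ ΘL ∘ʳ wkΘ Θ)) u ≡ plugV L' v' → Good (cutB mul (pair s u) (renC there M)) →
  StepTraces (cut mul (pair s u) (plugT (renC there M) (par (wkΘ Θ here) k1 k2 (ren (lift (lift (liftΘ Θ there))) t))))
             (λ z → DFV (cutB mul (pair s u) (renC there M)) z)
             (plugT M (plugT L (cut k1 v (plugT L' (cut k2 v' (ren (lift (wkΘ ΘL' ∘ʳ lift (wkΘ ΘL))) t))))))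
traces-tensor {Γ} {Θ} {ΘL} {ΘL'} {k1} {k2} s u M t L isL v eqL L' isL' v' eqL' (g-cut gM _) =
  traces-fired-cut {E = E} (λ {_} {z} → DFV-ren there M z) (traces-good-context there hereBlocked E M (good-ren⁻ there M gM) X Y hole-traces)
  where
  ρΘ : Ren (Θ ⋈ Γ) (Θ ⋈ (mul ∷ Γ))
  ρΘ = liftΘ Θ there
  mΘ : (Θ ⋈ (mul ∷ Γ)) ∋ mul
  mΘ = wkΘ Θ here
  T₀ = ren (lift (lift ρΘ)) t
  Y = par mΘ k1 k2 T₀
  body = plugT (renC there M) Y
  E = BadPosition (cut mul (pair s u) body)
  R = ren (lift (wkΘ ΘL' ∘ʳ lift (wkΘ ΘL))) t
  X₂ = plugT L' (cut k2 v' R)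
  X = plugT L (cut k1 v X₂)
  Bl₀ : Blocked (k2 ∷ k1 ∷ (Θ ⋈ (mul ∷ Γ)))
  Bl₀ = blockedLike² mΘ (liftBlockedΘ Θ hereBlocked)
  cutVarBlocked : liftBlockedΘ Θ hereBlocked mΘ
  cutVarBlocked = liftBlockedΘ-wk Θ hereBlocked here tt
  φ₀ : PartialRen (Θ ⋈ Γ) (k2 ∷ k1 ∷ (Θ ⋈ (mul ∷ Γ)))
  φ₀ z = maybe-map (λ y → there (there y)) (total ρΘ z)
  inside-s : ∀ {Θ' σ} (B : CtxT Γ Θ' σ) (w : Val (Θ' ⋈ Γ)) → s ≡ plugV B w → E (sizeV w)
  inside-s B w e = badPosition (cutV mul (pairL B u) body) w cutV-bad (cong (λ z → cut mul (pair z u) body) e) refl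
  inside-u : ∀ {Θ' σ} (B : CtxT Γ Θ' σ) (w : Val (Θ' ⋈ Γ)) → u ≡ plugV B w → E (sizeV w)
  inside-u B w e = badPosition (cutV mul (pairR s B) body) w cutV-bad (cong (λ z → cut mul (pair s z) body) e) refl
  inside-L : AllSizes E (plug L (val v))
  inside-L B w e = badPosition-ren s _ inside-s (wkΘ Θ) B w (trans eqL e)
  inside-L' : AllSizes E (plug L' (val v'))
  inside-L' B w e = badPosition-ren u _ inside-u (there ∘ʳ (wkΘ ΘL ∘ʳ wkΘ Θ)) B w (trans eqL' e)
  φ₁ : PartialRen (k1 ∷ (ΘL ⋈ (Θ ⋈ Γ))) (k2 ∷ k1 ∷ (Θ ⋈ (mul ∷ Γ)))
  φ₁ = consPartial (there here) (extNothingΘ ΘL φ₀)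
  φ₂ : PartialRen (k2 ∷ (ΘL' ⋈ (k1 ∷ (ΘL ⋈ (Θ ⋈ Γ))))) (k2 ∷ k1 ∷ (Θ ⋈ (mul ∷ Γ)))
  φ₂ = consPartial here (extNothingΘ ΘL' φ₁)
  agree : ∀ {k'} (x : (k2 ∷ k1 ∷ (Θ ⋈ Γ)) ∋ k') → φ₂ (lift (wkΘ ΘL' ∘ʳ lift (wkΘ ΘL)) x) ≡ just (lift (lift ρΘ) x)
  agree here              = refl
  agree (there here)      = extNothingΘ-wk ΘL' φ₁ here
  agree (there (there y)) = trans (extNothingΘ-wk ΘL' φ₁ (there (wkΘ ΘL y))) (extNothingΘ-wk ΘL φ₀ y)
  traces-body₂ : AllSizes E (val v') → Traces (extNothingΘ ΘL' φ₁) Bl₀ E (λ _ → ⊥) T₀ (cut k2 v' R)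
  traces-body₂ hv = traces-cut-target {φ = φ₂} {E = E} v' R (λ B' nd d → nd here cutVarBlocked d) hv
    (traces-ren {E = E} (lift (wkΘ ΘL' ∘ʳ lift (wkΘ ΘL))) (lift (lift ρΘ)) t refl agree)
  traces-body₁ : AllSizes E (val v) → Traces (extNothingΘ ΘL φ₀) Bl₀ E (λ _ → ⊥) T₀ (cut k1 v X₂)
  traces-body₁ hv = traces-cut-target {φ = φ₁} {E = E} v X₂ (λ B' nd d → nd (there here) cutVarBlocked d) hv
    (traces-left {Bl = Bl₀} {E = E} L' isL' φ₁ T₀ (cut k2 v' R) v' inside-L' traces-body₂)
  hole-traces : Traces (total (liftΘ Θ there)) (liftBlockedΘ Θ hereBlocked) E (λ _ → ⊥) Y X
  hole-traces = traces-par-source {E = E} mΘ (traces-left {Bl = Bl₀} {E = E} L isL φ₀ T₀ (cut k1 v X₂) v inside-L traces-body₁)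

root-traces : ∀ {Γ Θ s} {t u : Tm Γ} {P : CtxT Γ Θ s} → Root t P u → Good P → StepTraces t (λ z → DFV P z) u
root-traces (ax-m1 vm _ M _)                            g = traces-ax-m1 vm M g
root-traces (ax-m2 n t D _)                             g = traces-ax-m2 n t D g
root-traces (tensor s u M _ t L isL v e L' isL' v' e') g = traces-tensor s u M t L isL v e L' isL' v' e' g
root-traces (lolli s M _ v t L isL v' e)                g = traces-lolli s M v t L isL v' e g
root-traces (ax-e1 ve _ C)                              g = traces-ax-e1 ve C g
root-traces (ax-e2 f C t)                               g = traces-ax-e2 f C t g
root-traces (bang-der s C t L isL v e)                  g = traces-bang-der s C t L isL v e g
root-traces (weak ve _ t)                               g = traces-weak ve t

-- Closure under contexts

origin-id-lift : ∀ {Γ Θ σ k'} {T : Tm (k' ∷ Γ)} {B : CtxT (k' ∷ Γ) Θ σ} {v} →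
  Origin (total idRen) noneBlocked T B v → Origin (total (lift idRen)) (liftBlocked noneBlocked) T B v
origin-id-lift = origin-conv (λ z → cong just (sym (lift-id idRen (λ _ → refl) z))) (λ _ ())

origin-id-lift² : ∀ {Γ Θ σ k1 k2} {T : Tm (k2 ∷ k1 ∷ Γ)} {B : CtxT (k2 ∷ k1 ∷ Γ) Θ σ} {v} →
  Origin (total idRen) noneBlocked T B v → Origin (total (lift (lift idRen))) (liftBlocked (liftBlocked noneBlocked)) T B v
origin-id-lift² = origin-conv (λ z → cong just (sym (lift-id (lift idRen) (lift-id idRen (λ _ → refl)) z))) (λ _ ())

mutual
  step-traces : ∀ {Γ Θ s} {t u : Tm Γ} {P : CtxT Γ Θ s} → Step t P u → Good P → StepTraces t (λ z → DFV P z) u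
  step-traces (root r) g = root-traces r g
  step-traces (valS st) g hole v e = inj₂ (inj₂ GoodWithin-hole)
  step-traces (valS st) (g-val g) (val V) v e =
    map₃ (origin-val idRen noneBlocked)
      (λ { (badPositionV B' v' bad eq sz) → badPosition (val B') v' (λ { (g-val g) → bad g }) (cong val eq) sz })
      GoodWithin-val (stepV-traces st g V v (val-injective e))
  step-traces (subVS st) g (subH _ _ _) v refl = inj₂ (inj₂ (GoodWithin-mono inj₁ GoodWithin-subH))
  step-traces (subVS {m = m} {k = k} {b = b} st) (g-subV g) (subV _ V _ _) v e with sub-injective e
  ... | refl , refl , e₁ , refl =
    map₃ (origin-subV idRen noneBlocked)
      (λ { (badPositionV B' v' bad eq sz) →
             badPosition (subV m B' k b) v' (λ { (g-subV g) → bad g }) (cong (λ z → sub m z k b) eq) sz })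
      GoodWithin-subV (stepV-traces st g V v e₁)
  step-traces (subVS {v = w} {m = m} {k = k} st) g (subB _ _ _ B) v e with sub-injective e
  ... | refl , refl , refl , e₂ = inj₁ (origin (subB m w k B) v (cong (sub m w k) e₂) refl
          λ { (g-subB g) _ → g-subB g , λ z d → d })
  step-traces (cutBS {k = k} {v = w} {t = t} st) g (cutH _ _) v refl = inj₁ (origin-bad (cutH k t) w cutH-bad refl refl)
  step-traces (cutBS {k = k} {t = t} st) g (cutV _ V _) v e with cut-injective e
  ... | refl , e₁ , refl = inj₁ (origin-bad (cutV k V t) v cutV-bad (cong (λ z → cut k z t) e₁) refl)
  step-traces (cutBS {k = k} {v = w} st) (g-cut g nd) (cutB _ _ B) v e with cut-injective e
  ... | refl , refl , e₂ =
    map₃ (λ o → origin-cut idRen noneBlocked (origin-id-lift o))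
      (λ { (badPosition B' v' bad eq sz) → badPosition (cutB k w B') v' (λ { (g-cut g _) → bad g }) (cong (cut k w) eq) sz })
      (GoodWithin-cut nd) (step-traces st g B v e₂)
  step-traces (parBS {m = m} {k1} {k2} st) (g-par g) (parB _ _ _ B) v e with par-injective e
  ... | refl , refl , refl , e₂ =
    map₃ (λ o → origin-par idRen noneBlocked (origin-id-lift² o))
      (λ { (badPosition B' v' bad eq sz) →
             badPosition (parB m k1 k2 B') v' (λ { (g-par g) → bad g }) (cong (par m k1 k2) eq) sz })
      GoodWithin-par (step-traces st g B v e₂)
  step-traces (subBS {m = m} {v = w} {k = k} {t = t} st) g (subH _ _ _) v refl =
    inj₁ (origin (subH m k t) w refl refl λ _ _ → GoodWithin-subH)
  step-traces (subBS {m = m} {k = k} {t = t} st) g (subV _ V _ _) v e with sub-injective e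
  ... | refl , refl , e₁ , refl = inj₁ (origin (subV m V k t) v (cong (λ z → sub m z k t) e₁) refl
          λ { (g-subV g) _ → g-subV g , λ z d → d })
  step-traces (subBS {m = m} {v = w} {k = k} st) (g-subB g) (subB _ _ _ B) v e with sub-injective e
  ... | refl , refl , refl , e₂ =
    map₃ (λ o → origin-sub idRen noneBlocked (origin-id-lift o))
      (λ { (badPosition B' v' bad eq sz) →
             badPosition (subB m w k B') v' (λ { (g-subB g) → bad g }) (cong (sub m w k) eq) sz })
      GoodWithin-sub (step-traces st g B v e₂)
  step-traces (derBS {e = m} {k = k} st) (g-der g) (derB _ _ B) v e with der-injective e
  ... | refl , refl , e₂ =
    map₃ (λ o → origin-der idRen noneBlocked (origin-id-lift o))
      (λ { (badPosition B' v' bad eq sz) → badPosition (derB m k B') v' (λ { (g-der g) → bad g }) (cong (der m k) eq) sz })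
      GoodWithin-der (step-traces st g B v e₂)

  stepV-traces : ∀ {Γ Θ s} {w w' : Val Γ} {Q : VCtx Γ Θ s} → StepV w Q w' → GoodV Q → StepTracesV w (λ z → DFVV Q z) w'
  stepV-traces (pairLS {u = u} st) (gv-pairL g) (pairL B _) v e with pair-injective e
  ... | e₁ , refl =
    map₃ (origin-pairL idRen noneBlocked)
      (λ { (badPosition B' v' bad eq sz) →
             badPositionV (pairL B' u) v' (λ { (gv-pairL g) → bad g }) (cong (λ z → pair z u) eq) sz })
      GoodWithinV-pairL (step-traces st g B v e₁)
  stepV-traces (pairLS {t = t} st) g (pairR _ B) v e with pair-injective e
  ... | refl , e₂ = inj₁ (originV (pairR t B) v (cong (pair t) e₂) refl λ { (gv-pairR g) _ → gv-pairR g , λ z d → d })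
  stepV-traces (pairRS {t = t} st) (gv-pairR g) (pairR _ B) v e with pair-injective e
  ... | refl , e₂ =
    map₃ (origin-pairR idRen noneBlocked)
      (λ { (badPosition B' v' bad eq sz) → badPositionV (pairR t B') v' (λ { (gv-pairR g) → bad g }) (cong (pair t) eq) sz })
      GoodWithinV-pairR (step-traces st g B v e₂)
  stepV-traces (pairRS {u = u} st) g (pairL B _) v e with pair-injective e
  ... | e₁ , refl = inj₁ (originV (pairL B u) v (cong (λ z → pair z u) e₁) refl λ { (gv-pairL g) _ → gv-pairL g , λ z d → d })
  stepV-traces (lamS {k = k} st) (gv-lam g) (lam _ B) v e with lam-injective e
  ... | refl , e₁ =
    map₃ (λ o → origin-lam idRen noneBlocked (origin-id-lift o))
      (λ { (badPosition B' v' bad eq sz) → badPositionV (lam k B') v' (λ { (gv-lam g) → bad g }) (cong (lam k) eq) sz })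
      GoodWithinV-lam (step-traces st g B v e₁)
  stepV-traces (bangS st) (gv-bang g) (bang B) v e =
    map₃ (origin-bang idRen noneBlocked)
      (λ { (badPosition B' v' bad eq sz) → badPositionV (bang B') v' (λ { (gv-bang g) → bad g }) (cong bang eq) sz })
      GoodWithinV-bang (step-traces st g B v (bang-injective e))

proposition11p8 : ∀ {Γ : Scope} {t u : Tm Γ} {Θp : List Kind} {sp : HSort} {P : CtxT Γ Θp sp}
    → GoodStep t P u
    → ∀ {Θ : List Kind} {σ : HSort} (B : CtxT Γ Θ σ) (v : Val (Θ ⋈ Γ))
    → Bad B → u ≡ plugV B v
    → Σ (List Kind) λ Θ' → Σ HSort λ σ' → Σ (CtxT Γ Θ' σ') λ B' → Σ (Val (Θ' ⋈ Γ)) λ v'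
        → Bad B' × t ≡ plugV B' v' × sizeV v ≡ sizeV v'
proposition11p8 (step , good) B v bad e with step-traces step good B v e
... | inj₁ (origin B' v' eq sz reflect) = _ , _ , B' , v' , (λ g' → bad (proj₁ (reflect g' λ _ ()))) , eq , sz
... | inj₂ (inj₁ (badPosition B' v' bad' eq sz)) = _ , _ , B' , v' , bad' , eq , sz
... | inj₂ (inj₂ (g , _)) = ⊥-elim (bad g)
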